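{- Let $n,d,r$ be positive integers with $r>1$. For each noncrossing set partition $\gamma\in\mathcal{NC}(n,d,r)$, choose an ordering of its blocks, giving an ordered set partition $\pi_\gamma\in\mathcal{OP}(n,d,r)$. Then the family $\{[\pi_\gamma]_r:\gamma\in\mathcal{NC}(n,d,r)\}$ is linearly independent in $\mathbb{C}[M]$.
   Context: An (unordered) set partition of $[n]$ is a set of nonempty pairwise disjoint subsets (blocks) with union $[n]$; it is noncrossing if there are no $a<b<c<e$ in $[n]$ with $a,c$ in one block and $b,e$ in a different block. $\mathcal{NC}(n,d,r)$ is the set of noncrossing set partitions of $[n]$ with $d$ blocks, each of size at least $r$. An ordered set partition with $d$ blocks is a sequence $\pi=(\pi_1\mid\cdots\mid\pi_d)$ of such blocks; $\mathcal{OP}(n,d,r)$ is the set of those with every block of size at least $r$. Let $M=(x_{ij})_{1\le i,j\le n}$ be an $n\times n$ matrix of distinct indeterminates; $M_I^J$ is the determinant of the submatrix with rows $I$ and columns $J$ (both increasing). For $\pi\in\mathcal{OP}(n,d,r)$, an $r$-jellyfish tableau for $\pi$ is an array $T$ with $n-(d-1)r$ rows and $d$ columns, cells empty or containing elements of $[n]$, such that all cells in rows $1,\dots,r$ are nonempty, each row $i>r$ has exactly one nonempty cell, and the nonempty entries of column $j$ are exactly $\pi_j$, increasing downward; $\mathcal{J}_r(\pi)$ is their set. $\mathrm{sgn}(T)=(-1)^{\mathrm{inv}(T)}$, $\mathrm{inv}(T)$ being the number of inversions of the row reading word (rows left to right, top to bottom, empty cells skipped). $\mathrm{J}(T)=\prod_jM^{\pi_j}_{R_j(T)}$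 with $R_j(T)$ the set of rows in which column $j$ is nonempty, and $[\pi]_r=\sum_{T\in\mathcal{J}_r(\pi)}\mathrm{sgn}(T)\mathrm{J}(T)$. -}

module Defs where

open import Level using (_⊔_)
open import Data.Bool using (Bool; true; false; _∧_; _∨_; not; if_then_else_)
open import Data.Nat as ℕ using (ℕ; zero; suc; _∸_; _<_; _≤_; _<ᵇ_; _≤ᵇ_; _≡ᵇ_)
open import Data.Nat.Properties using (m∸n≤m)
open import Data.Fin as Fin using (Fin; toℕ; inject≤)
open import Data.Fin.Properties using (_≟_)
open import Data.Integer as ℤ using (ℤ; +_; -[1+_])
open import Data.Maybe using (Maybe; just; nothing; is-just)
open import Data.List as List using (List; []; _∷_; _++_; map; concatMap; mapMaybe; length; filter; filterᵇ; foldr; zip; allFin)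
open import Data.Vec as Vec using (Vec; lookup)
open import Data.Product using (_×_; _,_; ∃)
open import Relation.Nullary using (¬_)
open import Relation.Nullary.Decidable using (⌊_⌋)
open import Relation.Binary.PropositionalEquality using (_≡_; _≢_)
open import Algebra.Bundles using (CommutativeRing)

-- Set partitions of [n] = Fin n (elements 0..n-1, order as in [n]).
-- An ordered set partition (π₁ | ⋯ | π_d) is encoded by its block map
-- f : Fin n → Fin d, where π_j = f⁻¹(j).

block : {n d : ℕ} → (Fin n → Fin d) → Fin d → List (Fin n)
block {n} f j = filter (λ x → f x ≟ j) (allFin n)

IsOP : (n d r : ℕ) → (Fin n → Fin d) → Set
IsOP n d r f = (∀ j → ∃ λ x → f x ≡ j) × (∀ j → r ≤ length (block f j))

IsNoncrossing : {n d : ℕ} → (Fin n → Fin d) → Set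
IsNoncrossing {n} f = ∀ (a b c e : Fin n) →
  ¬ (a Fin.< b × b Fin.< c × c Fin.< e × f a ≡ f c × f b ≡ f e × f a ≢ f b)

SamePartition : {n d : ℕ} → (Fin n → Fin d) → (Fin n → Fin d) → Set
SamePartition f g = ∀ a b → (f a ≡ f b → g a ≡ g b) × (g a ≡ g b → f a ≡ f b)

-- Polynomials in the variables x_{ij}, i,j ∈ Fin n, with ℤ coefficients,
-- as formal sums of terms (coefficient, list of variables).

Var : ℕ → Set
Var n = Fin n × Fin n

Poly : ℕ → Set
Poly n = List (ℤ × List (Var n))

polyMul : {n : ℕ} → Poly n → Poly n → Poly n
polyMul p q = concatMap (λ { (a , u) → map (λ { (b , v) → (a ℤ.* b , u ++ v) }) q }) p

polyOne : {n : ℕ} → Poly n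
polyOne = (ℤ.+ 1 , []) ∷ []

polyProd : {n : ℕ} → List (Poly n) → Poly n
polyProd = foldr polyMul polyOne

polyScale : {n : ℕ} → ℤ → Poly n → Poly n
polyScale s = map (λ { (a , u) → (s ℤ.* a , u) })

allF : (k : ℕ) → (Fin k → Bool) → Bool
allF k p = List.foldr _∧_ true (map p (allFin k))

anyF : (k : ℕ) → (Fin k → Bool) → Bool
anyF k p = List.foldr _∨_ false (map p (allFin k))

countF : (k : ℕ) → (Fin k → Bool) → ℕ
countF k p = length (filterᵇ p (allFin k))

_⇒ᵇ_ : Bool → Bool → Bool
a ⇒ᵇ b = not a ∨ b

_==_ : {k : ℕ} → Fin k → Fin k → Bool
x == y = ⌊ x ≟ y ⌋

countVar : {n : ℕ} → Var n → List (Var n) → ℕ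
countVar v [] = 0
countVar (i , j) ((i' , j') ∷ u) =
  (if (i == i') ∧ (j == j') then 1 else 0) ℕ.+ countVar (i , j) u

Exponent : ℕ → Set
Exponent n = Fin n → Fin n → ℕ

coeff : {n : ℕ} → Poly n → Exponent n → ℤ
coeff {n} [] e = ℤ.+ 0
coeff {n} ((a , u) ∷ p) e =
  (if allF n (λ i → allF n (λ j → countVar (i , j) u ≡ᵇ e i j)) then a else ℤ.+ 0)
  ℤ.+ coeff p e

insertAll : {A : Set} → A → List A → List (List A)
insertAll x [] = (x ∷ []) ∷ []
insertAll x (y ∷ ys) = (x ∷ y ∷ ys) ∷ map (y ∷_) (insertAll x ys)

perms : {A : Set} → List A → List (List A)
perms [] = [] ∷ []
perms (x ∷ xs) = concatMap (insertAll x) (perms xs)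

inv : {n : ℕ} → List (Fin n) → ℕ
inv [] = 0
inv (x ∷ xs) = length (filterᵇ (λ y → toℕ y <ᵇ toℕ x) xs) ℕ.+ inv xs

sgn : ℕ → ℤ
sgn zero = ℤ.+ 1
sgn (suc k) = ℤ.- sgn k

-- M_I^J : determinant of the submatrix of M with rows I, columns J
-- (both increasing, of equal length), by the Leibniz formula.
minor : {n : ℕ} → List (Fin n) → List (Fin n) → Poly n
minor I J = map (λ σJ → (sgn (inv σJ) , zip I σJ)) (perms J)

nRows : ℕ → ℕ → ℕ → ℕ
nRows n d r = n ∸ ((d ∸ 1) ℕ.* r)

Array : ℕ → ℕ → ℕ → Set
Array n N d = Vec (Vec (Maybe (Fin n)) d) N

cell : {n N d : ℕ} → Array n N d → Fin N → Fin d → Maybe (Fin n)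
cell T i j = lookup (lookup T i) j

allVecs : {A : Set} → List A → (k : ℕ) → List (Vec A k)
allVecs xs zero = Vec.[] ∷ []
allVecs xs (suc k) = concatMap (λ x → map (x Vec.∷_) (allVecs xs k)) xs

allArrays : (n N d : ℕ) → List (Array n N d)
allArrays n N d = allVecs (allVecs (nothing ∷ map just (allFin n)) d) N

isEntry : {n : ℕ} → Maybe (Fin n) → Fin n → Bool
isEntry nothing x = false
isEntry (just y) x = y == x

increasingPair : {n : ℕ} → Maybe (Fin n) → Maybe (Fin n) → Bool
increasingPair (just x) (just y) = toℕ x <ᵇ toℕ y
increasingPair _ _ = true

isJellyfish : {n d : ℕ} (r : ℕ) → (Fin n → Fin d) → Array n (nRows n d r) d → Bool
isJellyfish {n} {d} r f T =
  allF N (λ i → (toℕ i <ᵇ r) ⇒ᵇ allF d (λ j → is-just (cell T i j)))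
  ∧ allF N (λ i → (r ≤ᵇ toℕ i) ⇒ᵇ (countF d (λ j → is-just (cell T i j)) ≡ᵇ 1))
  ∧ allF d (λ j → allF n (λ x →
        (anyF N (λ i → isEntry (cell T i j) x) ⇒ᵇ (f x == j))
      ∧ ((f x == j) ⇒ᵇ anyF N (λ i → isEntry (cell T i j) x))))
  ∧ allF d (λ j → allF N (λ i → allF N (λ i' →
        (toℕ i <ᵇ toℕ i') ⇒ᵇ increasingPair (cell T i j) (cell T i' j))))
  where N = nRows n d r

readingWord : {n N d : ℕ} → Array n N d → List (Fin n)
readingWord {n} {N} {d} T =
  concatMap (λ i → mapMaybe (λ j → cell T i j) (allFin d)) (allFin N)

-- R_j(T), as row indices of M (row i of T ↦ row i of M; N ≤ n)
rowSet : {n d : ℕ} (r : ℕ) → Array n (nRows n d r) d → Fin d → List (Fin n)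
rowSet {n} {d} r T j =
  map (λ i → inject≤ i (m∸n≤m n ((d ∸ 1) ℕ.* r)))
      (filterᵇ (λ i → is-just (cell T i j)) (allFin (nRows n d r)))

Jpoly : {n d : ℕ} (r : ℕ) → (Fin n → Fin d) → Array n (nRows n d r) d → Poly n
Jpoly {n} {d} r f T = polyProd (map (λ j → minor (rowSet r T j) (block f j)) (allFin d))

bracket : (n d r : ℕ) → (Fin n → Fin d) → Poly n
bracket n d r f =
  concatMap (λ T → if isJellyfish r f T
                   then polyScale (sgn (inv (readingWord T))) (Jpoly r f T)
                   else [])
            (allArrays n (nRows n d r) d)

module _ {c ℓ} (R : CommutativeRing c ℓ) where
  open CommutativeRing R

  natR : ℕ → Carrier
  natR zero = 0#
  natR (suc k) = 1# + natR k

  intR : ℤ → Carrier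
  intR (+ k) = natR k
  intR -[1+ k ] = - natR (suc k)

  IsCharZeroDomain : Set (c ⊔ ℓ)
  IsCharZeroDomain = (∀ k → ¬ (natR (suc k) ≈ 0#))
                   × (∀ x y → x * y ≈ 0# → (x ≈ 0#) Data.Sum.⊎ (y ≈ 0#))
    where import Data.Sum

  sumR : (k : ℕ) → (Fin k → Carrier) → Carrier
  sumR zero g = 0#
  sumR (suc k) g = g Fin.zero + sumR k (λ i → g (Fin.suc i))

  LinearlyIndependent : {n : ℕ} → List (Poly n) → Set (c ⊔ ℓ)
  LinearlyIndependent {n} ps =
    (a : Fin (length ps) → Carrier) →
    (∀ (e : Exponent n) →
       sumR (length ps) (λ k → a k * intR (coeff (List.lookup ps k) e)) ≈ 0#) →
    ∀ k → a k ≈ 0#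

module Submission where

-- The bracket [g]_r has a distinguished monomial: take any jellyfish tableau of g and pair the
-- rows of each column with the block rotated by one place, so that row 0 carries the block's
-- maximum and row 1 its minimum (both rows are full because r > 1).  In a term of [f]_r, every
-- full row meets every block of f exactly once; so if [f]_r contains that monomial, each block
-- of f contains exactly one block maximum and one block minimum of g.  For f = g this pins the
-- term down completely, so the coefficient is a nonzero multiple of a sign.  For f ≠ g it
-- makes the potential Σ (n − max) + min over the blocks strictly smaller for f than for g,
-- since a noncrossing partition is determined by its block maxima and minima.  The coefficient
-- matrix is therefore triangular with respect to the potential.

open import Defs
open import Algebra.Bundles using (Monoid; CommutativeRing)
open import Data.Bool as Bool using (Bool; true; false; _∧_; if_then_else_)
open import Data.Bool.Properties using (T-∧; T-≡)
open import Data.Empty using (⊥; ⊥-elim)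
open import Data.Fin as Fin using (Fin; toℕ)
import Data.Fin.Induction as Fin
import Data.Fin.Properties as Fin
open import Data.Integer as ℤ using (ℤ)
import Data.Integer.Properties as ℤ
open import Data.List as List using (List; []; _∷_; map; allFin)
import Data.List.Properties as List
open import Data.List.Membership.Propositional using (_∈_; find; lose)
open import Data.List.Membership.Propositional.Properties
  using (∈-lookup; ∈-filter⁻; ∈-filter⁺; ∈-allFin; ∈-++⁻; ∈-++⁺ˡ; ∈-++⁺ʳ; ∈-map⁻; ∈-map⁺; ∈-concatMap⁻; ∈-concatMap⁺)
open import Data.List.Relation.Binary.Permutation.Propositional using (_↭_; ↭-refl; ↭-prep; ↭-swap; ↭-trans)
open import Data.List.Relation.Binary.Permutation.Propositional.Properties using (∈-resp-↭; ↭-length)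
open import Data.List.Relation.Binary.Subset.Propositional using (_⊆_)
open import Data.List.Relation.Unary.All as All using (All)
import Data.List.Relation.Unary.All.Properties as All
open import Data.List.Relation.Unary.AllPairs as AllPairs using (AllPairs; []; _∷_)
import Data.List.Relation.Unary.AllPairs.Properties as AllPairs
open import Data.List.Relation.Unary.Any using (Any; here; there)
import Data.List.Relation.Unary.Any.Properties as Any
open import Data.List.Relation.Unary.Unique.Propositional using (Unique)
import Data.List.Relation.Unary.Unique.Propositional.Properties as Unique
open import Data.Maybe using (Maybe; just; nothing; is-just)
import Data.Maybe.Properties as Maybe
open import Data.Nat as ℕ using (ℕ; zero; suc; _+_; _∸_; _≤_; _<_; z≤n; s≤s)
import Data.Nat.Induction as ℕ
import Data.Nat.Properties as ℕ
open import Data.Product using (_×_; _,_; ∃; ∃!; proj₁; proj₂)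
import Data.Product as Product
open import Data.Product.Function.NonDependent.Propositional using (_×-⇔_)
open import Data.Sum using (inj₁; inj₂; [_,_]′)
open import Data.Vec as Vec using (Vec)
import Data.Vec.Properties as Vec
open import Data.Vec.Functional using (Vector)
open import Function using (_∘_; id; case_of_; _⇔_; mk⇔; Equivalence)
open import Function.Properties.Equivalence using () renaming (sym to ⇔-sym; refl to ⇔-refl; trans to ⇔-trans)
open import Induction.WellFounded using (module All)
open import Relation.Binary using (Tri; tri<; tri≈; tri>)
import Relation.Binary.Construct.On as On
open import Relation.Binary.PropositionalEquality
  using (_≡_; _≢_; refl; sym; trans; cong; cong₂; subst; subst₂; module ≡-Reasoning)
open import Relation.Nullary using (does; ¬_; yes; no; _→-dec_; _×-dec_)
open import Relation.Nullary.Decidable using (toWitness; fromWitness; dec-true; dec-false; isYes≗does)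
open import Relation.Unary using (Pred; Decidable)
open import Algebra.Properties.CommutativeMonoid.Sum ℕ.+-0-commutativeMonoid
  using (sum-syntax; ∑-comm; ∑-distrib-+; sum-cong-≗)

open Equivalence using (to; from)

T-⇒ᵇ : ∀ {a b} → Bool.T (a ⇒ᵇ b) ⇔ (Bool.T a → Bool.T b)
T-⇒ᵇ {true} = mk⇔ (λ b _ → b) (λ h → h _)
T-⇒ᵇ {false} = mk⇔ (λ _ ()) (λ _ → _)

T-== : ∀ {k} {x y : Fin k} → Bool.T (x == y) ⇔ x ≡ y
T-== = mk⇔ toWitness fromWitness

T-allF : ∀ k {p : Fin k → Bool} → Bool.T (allF k p) ⇔ (∀ i → Bool.T (p i))
T-allF k {p} = mk⇔ (All.tabulate⁻ ∘ All.all⁺ p (allFin k)) (All.all⁻ p ∘ All.tabulate⁺)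

T-anyF : ∀ k {p : Fin k → Bool} → Bool.T (anyF k p) ⇔ ∃ (Bool.T ∘ p)
T-anyF k {p} = mk⇔ (Any.tabulate⁻ ∘ Any.any⁻ p (allFin k)) (λ (i , pi) → Any.any⁺ p (Any.tabulate⁺ i pi))

==-refl : ∀ {k} (x : Fin k) → (x == x) ≡ true
==-refl x = trans (isYes≗does (x Fin.≟ x)) (dec-true (x Fin.≟ x) refl)

==-≢ : ∀ {k} {x y : Fin k} → x ≢ y → (x == y) ≡ false
==-≢ {x = x} {y} x≢y = trans (isYes≗does (x Fin.≟ y)) (dec-false (x Fin.≟ y) x≢y)

==-≡ : ∀ {k} {x y : Fin k} → x ≡ y → (x == y) ≡ true
==-≡ refl = ==-refl _

T-injective : ∀ {a b} → Bool.T a ⇔ Bool.T b → a ≡ b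
T-injective {false} {false} _ = refl
T-injective {false} {true} a⇔b = ⊥-elim (from a⇔b _)
T-injective {true} {false} a⇔b = ⊥-elim (to a⇔b _)
T-injective {true} {true} _ = refl

Increasing : ∀ {n} → List (Fin n) → Set
Increasing = AllPairs Fin._<_

module _ {a ℓ} {A : Set a} {_≺_ : A → A → Set ℓ} (≺-asym : ∀ {x y} → x ≺ y → ¬ y ≺ x) where

  AllPairs-⊆-antisym : ∀ {xs ys} → AllPairs _≺_ xs → AllPairs _≺_ ys → xs ⊆ ys → ys ⊆ xs → xs ≡ ys
  AllPairs-⊆-antisym {[]} {[]} _ _ _ _ = refl
  AllPairs-⊆-antisym {x ∷ _} {[]} _ _ xs⊆ys _ with () ← xs⊆ys (here refl)
  AllPairs-⊆-antisym {[]} {y ∷ _} _ _ _ ys⊆xs with () ← ys⊆xs (here refl)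
  AllPairs-⊆-antisym {x ∷ xs} {y ∷ ys} (x≺xs ∷ xs↗) (y≺ys ∷ ys↗) xs⊆ys ys⊆xs =
    cong₂ _∷_ x≡y (AllPairs-⊆-antisym xs↗ ys↗ (tail x≺xs x≡y xs⊆ys) (tail y≺ys (sym x≡y) ys⊆xs))
    where
    x≡y : x ≡ y
    x≡y with xs⊆ys (here refl) | ys⊆xs (here refl)
    ... | here x≡y | _ = x≡y
    ... | there _ | here y≡x = sym y≡x
    ... | there x∈ys | there y∈xs = ⊥-elim (≺-asym (All.lookup y≺ys x∈ys) (All.lookup x≺xs y∈xs))
    ≺-irrefl : ∀ {z} → ¬ z ≺ z
    ≺-irrefl z≺z = ≺-asym z≺z z≺z
    tail : ∀ {u us v vs} → All (u ≺_) us → u ≡ v → u ∷ us ⊆ v ∷ vs → us ⊆ vs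
    tail u≺us u≡v u∷us⊆v∷vs {z} z∈us with u∷us⊆v∷vs (there z∈us)
    ... | here refl = ⊥-elim (≺-irrefl (subst (_≺ z) u≡v (All.lookup u≺us z∈us)))
    ... | there z∈vs = z∈vs

module _ {a b} {A : Set a} {B : Set b} (h : A → Maybe B) where

  ∈-mapMaybe⁻ : ∀ xs {y} → y ∈ List.mapMaybe h xs → ∃ λ x → x ∈ xs × h x ≡ just y
  ∈-mapMaybe⁻ (x ∷ xs) y∈ with h x in hx
  ... | nothing = Product.map₂ (Product.map₁ there) (∈-mapMaybe⁻ xs y∈)
  ... | just _ with y∈
  ...   | here refl = x , here refl , hx
  ...   | there y∈′ = Product.map₂ (Product.map₁ there) (∈-mapMaybe⁻ xs y∈′)

  ∈-mapMaybe⁺ : ∀ xs {x y} → x ∈ xs → h x ≡ just y → y ∈ List.mapMaybe h xs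
  ∈-mapMaybe⁺ (x ∷ xs) (here refl) hx≡y rewrite hx≡y = here refl
  ∈-mapMaybe⁺ (x ∷ xs) (there x∈xs) hx≡y with h x
  ... | nothing = ∈-mapMaybe⁺ xs x∈xs hx≡y
  ... | just _ = there (∈-mapMaybe⁺ xs x∈xs hx≡y)

  mapMaybe-AllPairs : ∀ {q r} {Q : A → A → Set q} {R : B → B → Set r} {xs} → AllPairs Q xs →
    (∀ {x x′ y y′} → Q x x′ → h x ≡ just y → h x′ ≡ just y′ → R y y′) → AllPairs R (List.mapMaybe h xs)
  mapMaybe-AllPairs [] _ = []
  mapMaybe-AllPairs {xs = x ∷ xs} (x-Q ∷ xs-Q) related with h x in hx
  ... | nothing = mapMaybe-AllPairs xs-Q related
  ... | just y = All.tabulate y-R ∷ mapMaybe-AllPairs xs-Q related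
    where
    y-R : ∀ {y′} → y′ ∈ List.mapMaybe h xs → _
    y-R y′∈ with ∈-mapMaybe⁻ xs y′∈
    ... | x′ , x′∈xs , hx′ = related (All.lookup x-Q x′∈xs) hx hx′

  length-filter-is-just : ∀ xs → List.length (List.filterᵇ (is-just ∘ h) xs) ≡ List.length (List.mapMaybe h xs)
  length-filter-is-just [] = refl
  length-filter-is-just (x ∷ xs) with h x
  ... | nothing = length-filter-is-just xs
  ... | just _ = cong suc (length-filter-is-just xs)

  mapMaybe-determines : ∀ (h′ : A → Maybe B) xs → (∀ x → is-just (h x) ≡ is-just (h′ x)) →
    List.mapMaybe h xs ≡ List.mapMaybe h′ xs → ∀ {x} → x ∈ xs → h x ≡ h′ x
  mapMaybe-determines h′ (x ∷ xs) same-support eq x∈ with h x in hx | h′ x in h′x | same-support x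
  ... | nothing | nothing | _ = case x∈ of λ where
    (here refl) → trans hx (sym h′x)
    (there x∈xs) → mapMaybe-determines h′ xs same-support eq x∈xs
  ... | just y | just y′ | _ = case x∈ of λ where
    (here refl) → trans hx (trans (cong just (List.∷-injectiveˡ eq)) (sym h′x))
    (there x∈xs) → mapMaybe-determines h′ xs same-support (List.∷-injectiveʳ eq) x∈xs

module _ {a b} {A : Set a} {B : Set b} where

  ∈-zip⁻ˡ : ∀ {xs : List A} {ys : List B} {x y} → (x , y) ∈ List.zip xs ys → x ∈ xs
  ∈-zip⁻ˡ {_ ∷ _} {_ ∷ _} (here refl) = here refl
  ∈-zip⁻ˡ {_ ∷ _} {_ ∷ _} (there xy∈) = there (∈-zip⁻ˡ xy∈)

  ∈-zip⁻ʳ : ∀ {xs : List A} {ys : List B} {x y} → (x , y) ∈ List.zip xs ys → y ∈ ys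
  ∈-zip⁻ʳ {_ ∷ _} {_ ∷ _} (here refl) = here refl
  ∈-zip⁻ʳ {_ ∷ _} {_ ∷ _} (there xy∈) = there (∈-zip⁻ʳ xy∈)

  ∈-zip-partner : ∀ {xs : List A} {ys : List B} {x} → x ∈ xs → List.length xs ≡ List.length ys →
    ∃ λ y → (x , y) ∈ List.zip xs ys
  ∈-zip-partner {_ ∷ _} {y ∷ _} (here refl) _ = y , here refl
  ∈-zip-partner {_ ∷ _} {_ ∷ _} (there x∈) |xs|≡|ys| =
    Product.map₂ there (∈-zip-partner x∈ (ℕ.suc-injective |xs|≡|ys|))

  zip-functional : ∀ {xs : List A} {ys : List B} {x y y′} → Unique xs →
    (x , y) ∈ List.zip xs ys → (x , y′) ∈ List.zip xs ys → y ≡ y′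
  zip-functional {_ ∷ _} {_ ∷ _} _ (here refl) (here refl) = refl
  zip-functional {_ ∷ _} {_ ∷ _} (x∉ ∷ _) (here refl) (there xy′∈) = ⊥-elim (All.lookup x∉ (∈-zip⁻ˡ xy′∈) refl)
  zip-functional {_ ∷ _} {_ ∷ _} (x∉ ∷ _) (there xy∈) (here refl) = ⊥-elim (All.lookup x∉ (∈-zip⁻ˡ xy∈) refl)
  zip-functional {_ ∷ _} {_ ∷ _} (_ ∷ xs!) (there xy∈) (there xy′∈) = zip-functional xs! xy∈ xy′∈

  zip-injectiveʳ : ∀ {xs : List A} {ys ys′ : List B} → Unique xs →
    List.length xs ≡ List.length ys → List.length xs ≡ List.length ys′ →
    (∀ {x y} → (x , y) ∈ List.zip xs ys → (x , y) ∈ List.zip xs ys′) → ys ≡ ys′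
  zip-injectiveʳ {[]} {[]} {[]} _ _ _ _ = refl
  zip-injectiveʳ {x ∷ xs} {y ∷ ys} {y′ ∷ ys′} xs!@(x∉ ∷ tail!) |ys| |ys′| ⊆′ =
    cong₂ _∷_ (zip-functional xs! (⊆′ (here refl)) (here refl))
      (zip-injectiveʳ tail! (ℕ.suc-injective |ys|) (ℕ.suc-injective |ys′|) tail-⊆)
    where
    tail-⊆ : ∀ {u v} → (u , v) ∈ List.zip xs ys → (u , v) ∈ List.zip xs ys′
    tail-⊆ uv∈ with ⊆′ (there uv∈)
    ... | here refl = ⊥-elim (All.lookup x∉ (∈-zip⁻ˡ uv∈) refl)
    ... | there uv∈′ = uv∈′

module _ {A : Set} where

  ∈-insertAll⇒↭ : ∀ (x : A) ys {zs} → zs ∈ insertAll x ys → zs ↭ x ∷ ys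
  ∈-insertAll⇒↭ x [] (here refl) = ↭-refl
  ∈-insertAll⇒↭ x (y ∷ ys) (here refl) = ↭-refl
  ∈-insertAll⇒↭ x (y ∷ ys) (there zs∈) with ∈-map⁻ (y ∷_) zs∈
  ... | zs′ , zs′∈ , refl = ↭-trans (↭-prep y (∈-insertAll⇒↭ x ys zs′∈)) (↭-swap y x ↭-refl)

  ∈-perms⇒↭ : ∀ (xs : List A) {σ} → σ ∈ perms xs → σ ↭ xs
  ∈-perms⇒↭ [] (here refl) = ↭-refl
  ∈-perms⇒↭ (x ∷ xs) σ∈ with find (∈-concatMap⁻ (insertAll x) {xs = perms xs} σ∈)
  ... | τ , τ∈ , σ∈′ = ↭-trans (∈-insertAll⇒↭ x τ σ∈′) (↭-prep x (∈-perms⇒↭ xs τ∈))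

  lastOf : A → List A → A
  lastOf x [] = x
  lastOf x (y ∷ ys) = lastOf y ys

  rotate : List A → List A
  rotate [] = []
  rotate (x ∷ xs) = lastOf x xs ∷ initOf x xs
    where
    initOf : A → List A → List A
    initOf x [] = []
    initOf x (y ∷ ys) = x ∷ initOf y ys

  lastOf-∈ : ∀ x xs → lastOf x xs ∈ x ∷ xs
  lastOf-∈ x [] = here refl
  lastOf-∈ x (y ∷ ys) = there (lastOf-∈ y ys)

  rotate-∈-perms : ∀ xs → rotate xs ∈ perms xs
  rotate-∈-perms [] = here refl
  rotate-∈-perms (x ∷ []) = here refl
  rotate-∈-perms (x ∷ y ∷ ys) =
    ∈-concatMap⁺ (insertAll x) (lose (rotate-∈-perms (y ∷ ys)) (there (∈-map⁺ (lastOf y ys ∷_) (head-insertion _))))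
    where
    head-insertion : ∀ zs → x ∷ zs ∈ insertAll x zs
    head-insertion [] = here refl
    head-insertion (_ ∷ _) = here refl

module _ {n : ℕ} where

  head-minimal : ∀ {x : Fin n} {xs} → Increasing (x ∷ xs) → ∀ {z} → z ∈ x ∷ xs → x Fin.≤ z
  head-minimal _ (here refl) = Fin.≤-refl
  head-minimal (x<xs ∷ _) (there z∈xs) = ℕ.<⇒≤ (All.lookup x<xs z∈xs)

  lastOf-maximal : ∀ {x : Fin n} {xs} → Increasing (x ∷ xs) → ∀ {z} → z ∈ x ∷ xs → z Fin.≤ lastOf x xs
  lastOf-maximal {xs = []} _ (here refl) = Fin.≤-refl
  lastOf-maximal {xs = y ∷ ys} (x<xs ∷ xs↗) (here refl) =
    ℕ.<⇒≤ (ℕ.<-≤-trans (All.lookup x<xs (here refl)) (lastOf-maximal xs↗ (here refl)))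
  lastOf-maximal {xs = y ∷ ys} (_ ∷ xs↗) (there z∈xs) = lastOf-maximal xs↗ z∈xs

module _ {n : ℕ} {A : Set} where

  rotate-zip-extrema : ∀ {y₀ y₁ : A} {rest} (B : List (Fin n)) → Increasing B →
    List.length (y₀ ∷ y₁ ∷ rest) ≡ List.length B →
    (∃ λ M → M ∈ B × (∀ {z} → z ∈ B → z Fin.≤ M) × (y₀ , M) ∈ List.zip (y₀ ∷ y₁ ∷ rest) (rotate B)) ×
    (∃ λ m → m ∈ B × (∀ {z} → z ∈ B → m Fin.≤ z) × (y₁ , m) ∈ List.zip (y₀ ∷ y₁ ∷ rest) (rotate B))
  rotate-zip-extrema (b ∷ b′ ∷ bs) B↗ _ =
    (lastOf b′ bs , lastOf-∈ b (b′ ∷ bs) , lastOf-maximal B↗ , here refl) ,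
    (b , here refl , head-minimal B↗ , there (here refl))

module _ {A : Set} where

  nth : List A → ℕ → Maybe A
  nth [] _ = nothing
  nth (x ∷ xs) zero = just x
  nth (x ∷ xs) (suc k) = nth xs k

  nth-∈ : ∀ xs k {x} → nth xs k ≡ just x → x ∈ xs
  nth-∈ (y ∷ xs) zero refl = here refl
  nth-∈ (y ∷ xs) (suc k) eq = there (nth-∈ xs k eq)

  nth-just : ∀ xs {k} → k < List.length xs → ∃ λ x → nth xs k ≡ just x
  nth-just (y ∷ xs) {zero} _ = y , refl
  nth-just (y ∷ xs) {suc k} (s≤s k<) = nth-just xs k<

  ∈⇒nth : ∀ {xs x} → x ∈ xs → ∃ λ k → k < List.length xs × nth xs k ≡ just x
  ∈⇒nth (here refl) = 0 , s≤s z≤n , refl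
  ∈⇒nth (there x∈) = let (k , k< , eq) = ∈⇒nth x∈ in suc k , s≤s k< , eq

  nth-drop : ∀ m xs k → nth (List.drop m xs) k ≡ nth xs (m + k)
  nth-drop zero xs k = refl
  nth-drop (suc m) [] k = refl
  nth-drop (suc m) (y ∷ xs) k = nth-drop m xs k

  ∈-drop⁻ : ∀ m {xs : List A} {x} → x ∈ List.drop m xs → x ∈ xs
  ∈-drop⁻ zero x∈ = x∈
  ∈-drop⁻ (suc m) {_ ∷ _} x∈ = there (∈-drop⁻ m x∈)

  nth-AllPairs : ∀ {ℓ} {R : A → A → Set ℓ} {xs} → AllPairs R xs → ∀ {k k′ x x′} →
    nth xs k ≡ just x → nth xs k′ ≡ just x′ → k < k′ → R x x′
  nth-AllPairs {xs = _ ∷ xs} (y-R ∷ _) {zero} {suc k′} refl eq′ _ = All.lookup y-R (nth-∈ xs k′ eq′)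
  nth-AllPairs (_ ∷ xs-R) {suc k} {suc k′} eq eq′ (s≤s k<k′) = nth-AllPairs xs-R eq eq′ k<k′

cast-injective : ∀ {m m′} .{eq : m ≡ m′} {k k′ : Fin m} → Fin.cast eq k ≡ Fin.cast eq k′ → k ≡ k′
cast-injective {eq = eq} {k} {k′} casts≡ =
  Fin.toℕ-injective (trans (sym (Fin.toℕ-cast eq k)) (trans (cong toℕ casts≡) (Fin.toℕ-cast eq k′)))

module _ {A B : Set} where

  lookup-map : ∀ (F : A → B) xs k → List.lookup (map F xs) k ≡ F (List.lookup xs (Fin.cast (List.length-map F xs) k))
  lookup-map F (x ∷ xs) Fin.zero = refl
  lookup-map F (x ∷ xs) (Fin.suc k) = lookup-map F xs k

module _ {A : Set} where

  AllPairs-lookup : ∀ {ℓ} {R : A → A → Set ℓ} → (∀ {x y} → R x y → R y x) → ∀ {xs} → AllPairs R xs →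
    ∀ {i j} → i ≢ j → R (List.lookup xs i) (List.lookup xs j)
  AllPairs-lookup R-sym (_ ∷ _) {Fin.zero} {Fin.zero} i≢j = ⊥-elim (i≢j refl)
  AllPairs-lookup R-sym (x-R ∷ _) {Fin.zero} {Fin.suc j} _ = All.lookup x-R (∈-lookup j)
  AllPairs-lookup R-sym (x-R ∷ _) {Fin.suc i} {Fin.zero} _ = R-sym (All.lookup x-R (∈-lookup i))
  AllPairs-lookup R-sym (_ ∷ xs-R) {Fin.suc i} {Fin.suc j} i≢j = AllPairs-lookup R-sym xs-R (i≢j ∘ cong Fin.suc)

module _ {a p} {A : Set a} {P : A → Set p} where

  ∃!-≡ : ∃! _≡_ P → ∀ {x y} → P x → P y → x ≡ y
  ∃!-≡ (_ , _ , unique) px py = trans (sym (unique px)) (unique py)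

  ∃!-resp-⇔ : ∀ {q} {Q : A → Set q} → (∀ x → P x ⇔ Q x) → ∃! _≡_ P → ∃! _≡_ Q
  ∃!-resp-⇔ P⇔Q (x , px , unique) = x , to (P⇔Q x) px , unique ∘ from (P⇔Q _)

Vec-ext : ∀ {A : Set} {k} {u v : Vec A k} → (∀ i → Vec.lookup u i ≡ Vec.lookup v i) → u ≡ v
Vec-ext {u = u} {v} u≗v = trans (sym (Vec.tabulate∘lookup u)) (trans (Vec.tabulate-cong u≗v) (Vec.tabulate∘lookup v))

module _ {a ℓ} (M : Monoid a ℓ) where
  open Monoid M using (Carrier; _≈_; ∙-cong; ∙-congˡ; setoid)
    renaming (_∙_ to _+ₘ_; ε to 0ₘ; identityˡ to +ₘ-identityˡ; identityʳ to +ₘ-identityʳ)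
  open import Relation.Binary.Reasoning.Setoid setoid
  open import Algebra.Properties.Monoid.Sum M using () renaming (sum to sumₘ; sum-cong-≋ to sumₘ-cong; sum-replicate-zero to sumₘ-zero)

  sum-single : ∀ {m} (t : Vector Carrier m) i → (∀ j → j ≢ i → t j ≈ 0ₘ) → sumₘ t ≈ t i
  sum-single {suc m} t Fin.zero others = begin
    t Fin.zero +ₘ sumₘ (t ∘ Fin.suc)
      ≈⟨ ∙-congˡ (Monoid.trans M (sumₘ-cong (λ j → others (Fin.suc j) λ ())) (sumₘ-zero m)) ⟩
    t Fin.zero +ₘ 0ₘ                 ≈⟨ +ₘ-identityʳ _ ⟩
    t Fin.zero                       ∎
  sum-single {suc m} t (Fin.suc i) others = begin
    t Fin.zero +ₘ sumₘ (t ∘ Fin.suc)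
      ≈⟨ ∙-cong (others Fin.zero λ ()) (sum-single (t ∘ Fin.suc) i (λ j j≢i → others (Fin.suc j) (j≢i ∘ Fin.suc-injective))) ⟩
    0ₘ +ₘ t (Fin.suc i)              ≈⟨ +ₘ-identityˡ _ ⟩
    t (Fin.suc i)                    ∎

∑-indicator : ∀ {d} (a : Fin d) c → ∑[ j < d ] (if a == j then c else 0) ≡ c
∑-indicator a c = trans (sum-single ℕ.+-0-monoid _ a (λ j j≢a → cong (if_then c else 0) (==-≢ (j≢a ∘ sym))))
                        (cong (if_then c else 0) (==-refl a))

∑-const : ∀ k c → ∑[ i < k ] c ≡ k ℕ.* c
∑-const zero c = refl
∑-const (suc k) c = cong (c +_) (∑-const k c)

∑-fibres : ∀ {n d} (f : Fin n → Fin d) (h : Fin n → ℕ) →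
  ∑[ x < n ] h x ≡ ∑[ j < d ] ∑[ x < n ] (if f x == j then h x else 0)
∑-fibres f h = trans (sum-cong-≗ (λ x → sym (∑-indicator (f x) (h x)))) (∑-comm (λ x j → if f x == j then h x else 0))

∑-mono-≤ : ∀ {k} {u v : Fin k → ℕ} → (∀ i → u i ≤ v i) → ∑[ i < k ] u i ≤ ∑[ i < k ] v i
∑-mono-≤ {zero} _ = z≤n
∑-mono-≤ {suc k} u≤v = ℕ.+-mono-≤ (u≤v Fin.zero) (∑-mono-≤ (u≤v ∘ Fin.suc))

∑-mono-< : ∀ {k} {u v : Fin k → ℕ} → (∀ i → u i ≤ v i) → ∀ i → u i < v i → ∑[ i < k ] u i < ∑[ i < k ] v i
∑-mono-< u≤v Fin.zero u<v = ℕ.+-mono-<-≤ u<v (∑-mono-≤ (u≤v ∘ Fin.suc))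
∑-mono-< u≤v (Fin.suc i) u<v = ℕ.+-mono-≤-< (u≤v Fin.zero) (∑-mono-< (u≤v ∘ Fin.suc) i u<v)

length-filter-tabulate : ∀ {a p k} {A : Set a} {P : Pred A p} (P? : Decidable P) (g : Fin k → A) →
  List.length (List.filter P? (List.tabulate g)) ≡ ∑[ i < k ] (if does (P? (g i)) then 1 else 0)
length-filter-tabulate {k = zero} P? g = refl
length-filter-tabulate {k = suc k} P? g with does (P? (g Fin.zero))
... | true = cong suc (length-filter-tabulate P? (g ∘ Fin.suc))
... | false = length-filter-tabulate P? (g ∘ Fin.suc)

module _ {A : Set} where

  length-concatMap-tabulate : ∀ {m k} (F : Fin k → List A) (h : Fin m → Fin k) →
    List.length (List.concatMap F (List.tabulate h)) ≡ ∑[ i < m ] List.length (F (h i))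
  length-concatMap-tabulate {zero} F h = refl
  length-concatMap-tabulate {suc m} F h =
    trans (List.length-++ (F (h Fin.zero)) {List.concatMap F (List.tabulate (h ∘ Fin.suc))})
          (cong (List.length (F (h Fin.zero)) +_) (length-concatMap-tabulate F (h ∘ Fin.suc)))

-- Set partitions and their block extrema

module _ {n d : ℕ} (f : Fin n → Fin d) where

  ∈-block⁻ : ∀ {j x} → x ∈ block f j → f x ≡ j
  ∈-block⁻ {j} = proj₂ ∘ ∈-filter⁻ (λ x → f x Fin.≟ j) {xs = allFin n}

  ∈-block⁺ : ∀ {j x} → f x ≡ j → x ∈ block f j
  ∈-block⁺ {j} {x} = ∈-filter⁺ (λ x → f x Fin.≟ j) (∈-allFin x)

  block-increasing : ∀ j → Increasing (block f j)
  block-increasing j = AllPairs.filter⁺ (λ x → f x Fin.≟ j) (AllPairs.tabulate⁺-< id)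

IsBlockMax IsBlockMin : ∀ {n d} → (Fin n → Fin d) → Fin n → Set
IsBlockMax f x = ∀ y → f y ≡ f x → y Fin.≤ x
IsBlockMin f x = ∀ y → f y ≡ f x → x Fin.≤ y

module _ {n d : ℕ} (f : Fin n → Fin d) where
  open import Data.List.Extrema (Fin.≤-totalOrder n) using (max; min; argmax-all; argmin-all; xs≤max; min≤xs)

  blockMax blockMin : Fin n → Fin n
  blockMax x = max x (block f (f x))
  blockMin x = min x (block f (f x))

  blockMax-sameBlock : ∀ x → f (blockMax x) ≡ f x
  blockMax-sameBlock x = argmax-all id refl (All.tabulate (∈-block⁻ f))

  blockMin-sameBlock : ∀ x → f (blockMin x) ≡ f x
  blockMin-sameBlock x = argmin-all id refl (All.tabulate (∈-block⁻ f))

  blockMax-isBlockMax : ∀ x → IsBlockMax f (blockMax x)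
  blockMax-isBlockMax x y fy≡ = All.lookup (xs≤max x (block f (f x))) (∈-block⁺ f (trans fy≡ (blockMax-sameBlock x)))

  blockMin-isBlockMin : ∀ x → IsBlockMin f (blockMin x)
  blockMin-isBlockMin x y fy≡ = All.lookup (min≤xs x (block f (f x))) (∈-block⁺ f (trans fy≡ (blockMin-sameBlock x)))

  blockMax-unique : ∀ {a b} → IsBlockMax f a → IsBlockMax f b → f a ≡ f b → a ≡ b
  blockMax-unique a-max b-max fa≡fb = Fin.≤-antisym (b-max _ fa≡fb) (a-max _ (sym fa≡fb))

  blockMin-unique : ∀ {a b} → IsBlockMin f a → IsBlockMin f b → f a ≡ f b → a ≡ b
  blockMin-unique a-min b-min fa≡fb = Fin.≤-antisym (a-min _ (sym fa≡fb)) (b-min _ fa≡fb)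

  blockMin-≤ : ∀ x → blockMin x Fin.≤ x
  blockMin-≤ x = blockMin-isBlockMin x x (sym (blockMin-sameBlock x))

  blockMin-self : ∀ {x} → IsBlockMin f x → blockMin x ≡ x
  blockMin-self {x} x-min = blockMin-unique (blockMin-isBlockMin x) x-min (blockMin-sameBlock x)

  sameBlock⇔sameBlockMin : ∀ {x y} → f x ≡ f y ⇔ blockMin x ≡ blockMin y
  sameBlock⇔sameBlockMin {x} {y} = mk⇔
    (λ fx≡fy → blockMin-unique (blockMin-isBlockMin x) (blockMin-isBlockMin y)
                 (trans (blockMin-sameBlock x) (trans fx≡fy (sym (blockMin-sameBlock y)))))
    (λ mx≡my → trans (sym (blockMin-sameBlock x)) (trans (cong f mx≡my) (blockMin-sameBlock y)))

SamePartition-sym : ∀ {n d} {f g : Fin n → Fin d} → SamePartition f g → SamePartition g f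
SamePartition-sym same a b = Product.swap (same a b)

SameExtrema : ∀ {n d} → (Fin n → Fin d) → (Fin n → Fin d) → Set
SameExtrema q g = (∀ x → IsBlockMax q x ⇔ IsBlockMax g x) × (∀ x → IsBlockMin q x ⇔ IsBlockMin g x)

SameExtrema-sym : ∀ {n d} {q g : Fin n → Fin d} → SameExtrema q g → SameExtrema g q
SameExtrema-sym (maxima , minima) = (⇔-sym ∘ maxima) , (⇔-sym ∘ minima)

module _ {n d : ℕ} where

  -- If the q-block of x began strictly before its g-block, then the q-block of b = blockMin g x
  -- would either cross the q-block of x, or end before x; in the latter case the induction
  -- hypothesis at its maximum would put that maximum into the g-block of x.
  private
    blockMin-≮ : {q g : Fin n → Fin d} → IsNoncrossing q → SameExtrema q g → ∀ x →
      (∀ {y} → y Fin.< x → blockMin q y ≡ blockMin g y) → ¬ (blockMin q x Fin.< blockMin g x)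
    blockMin-≮ {q} {g} q-nc (maxima , minima) x IH a<b = crossing (Fin.<-cmp M x)
      where
      a = blockMin q x
      b = blockMin g x
      M = blockMax q b
      b-qmin : IsBlockMin q b
      b-qmin = from (minima b) (blockMin-isBlockMin g x)
      qb≢qx : q b ≢ q x
      qb≢qx qb≡qx = Fin.<⇒≢ a<b (sym (trans (sym (blockMin-self q b-qmin)) (to (sameBlock⇔sameBlockMin q) qb≡qx)))
      b<x : b Fin.< x
      b<x = Fin.≤∧≢⇒< (blockMin-≤ g x) (qb≢qx ∘ cong q)
      crossing : Tri (M Fin.< x) (M ≡ x) (x Fin.< M) → ⊥
      crossing (tri≈ _ M≡x _) = qb≢qx (trans (sym (blockMax-sameBlock q b)) (cong q M≡x))
      crossing (tri> _ _ x<M) = q-nc a b x M (a<b , b<x , x<M , blockMin-sameBlock q x ,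
        sym (blockMax-sameBlock q b) , λ qa≡qb → qb≢qx (trans (sym qa≡qb) (blockMin-sameBlock q x)))
      crossing (tri< M<x _ _) = ℕ.<⇒≱ M<x (to (maxima M) (blockMax-isBlockMax q b) x (sym gM≡gx))
        where
        gM≡gx : g M ≡ g x
        gM≡gx = from (sameBlock⇔sameBlockMin g)
          (trans (sym (IH M<x)) (trans (to (sameBlock⇔sameBlockMin q) (blockMax-sameBlock q b)) (blockMin-self q b-qmin)))

  blockMin-agree : {q g : Fin n → Fin d} → IsNoncrossing q → IsNoncrossing g → SameExtrema q g →
    ∀ x → blockMin q x ≡ blockMin g x
  blockMin-agree {q} {g} q-nc g-nc same = All.wfRec Fin.<-wellFounded _ _ step
    where
    step : ∀ x → (∀ {y} → y Fin.< x → blockMin q y ≡ blockMin g y) → blockMin q x ≡ blockMin g x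
    step x IH with Fin.<-cmp (blockMin q x) (blockMin g x)
    ... | tri≈ _ eq _ = eq
    ... | tri< lt _ _ = ⊥-elim (blockMin-≮ q-nc same x IH lt)
    ... | tri> _ _ gt = ⊥-elim (blockMin-≮ g-nc (SameExtrema-sym same) x (λ y<x → sym (IH y<x)) gt)

  noncrossing-determined-by-extrema : {q g : Fin n → Fin d} → IsNoncrossing q → IsNoncrossing g →
    SameExtrema q g → SamePartition q g
  noncrossing-determined-by-extrema {q} {g} q-nc g-nc same a b =
    (λ qa≡qb → from (sameBlock⇔sameBlockMin g) (trans (sym (agree a)) (trans (to (sameBlock⇔sameBlockMin q) qa≡qb) (agree b)))) ,
    (λ ga≡gb → from (sameBlock⇔sameBlockMin q) (trans (agree a) (trans (to (sameBlock⇔sameBlockMin g) ga≡gb) (sym (agree b)))))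
    where
    agree = blockMin-agree q-nc g-nc same

∑-length-block : ∀ {n d} (g : Fin n → Fin d) → ∑[ j < d ] List.length (block g j) ≡ n
∑-length-block {n} {d} g = begin
  ∑[ j < d ] List.length (block g j)
    ≡⟨ sum-cong-≗ (λ j → length-filter-tabulate (λ x → g x Fin.≟ j) id) ⟩
  ∑[ j < d ] ∑[ x < n ] (if does (g x Fin.≟ j) then 1 else 0)
    ≡⟨ sum-cong-≗ (λ j → sum-cong-≗ (λ x → cong (if_then 1 else 0) (sym (isYes≗does (g x Fin.≟ j))))) ⟩
  ∑[ j < d ] ∑[ x < n ] (if g x == j then 1 else 0)
    ≡⟨ ∑-fibres g (λ _ → 1) ⟨
  ∑[ x < n ] 1
    ≡⟨ ∑-const n 1 ⟩
  n ℕ.* 1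
    ≡⟨ ℕ.*-identityʳ n ⟩
  n ∎
  where open ≡-Reasoning

-- The potential

module _ {n d : ℕ} where

  isBlockMax? : (f : Fin n → Fin d) → Decidable (IsBlockMax f)
  isBlockMax? f x = Fin.all? (λ y → (f y Fin.≟ f x) →-dec (y Fin.≤? x))

  isBlockMin? : (f : Fin n → Fin d) → Decidable (IsBlockMin f)
  isBlockMin? f x = Fin.all? (λ y → (f y Fin.≟ f x) →-dec (x Fin.≤? y))

  weight : (Fin n → Fin d) → Fin n → ℕ
  weight f x = (if does (isBlockMax? f x) then n ∸ toℕ x else 0) + (if does (isBlockMin? f x) then toℕ x else 0)

  potential : (Fin n → Fin d) → ℕ
  potential f = ∑[ x < n ] weight f x

  record ExtremaTransversal (f g : Fin n → Fin d) : Set where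
    field
      maxIn : Fin d → Fin n
      maxIn-inBlock : ∀ j → f (maxIn j) ≡ j
      maxIn-isBlockMax : ∀ j → IsBlockMax g (maxIn j)
      maxIn-unique : ∀ {j c} → f c ≡ j → IsBlockMax g c → c ≡ maxIn j
      minIn : Fin d → Fin n
      minIn-inBlock : ∀ j → f (minIn j) ≡ j
      minIn-isBlockMin : ∀ j → IsBlockMin g (minIn j)
      minIn-unique : ∀ {j c} → f c ≡ j → IsBlockMin g c → c ≡ minIn j

  self-transversal : ∀ {f} → (∀ j → ∃ λ x → f x ≡ j) → ExtremaTransversal f f
  self-transversal {f} nonempty = record
    { maxIn = λ j → blockMax f (witness j)
    ; maxIn-inBlock = λ j → trans (blockMax-sameBlock f (witness j)) (inBlock j)
    ; maxIn-isBlockMax = λ j → blockMax-isBlockMax f (witness j)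
    ; maxIn-unique = λ {j} fc≡j c-max → blockMax-unique f c-max (blockMax-isBlockMax f (witness j))
        (trans fc≡j (sym (trans (blockMax-sameBlock f (witness j)) (inBlock j))))
    ; minIn = λ j → blockMin f (witness j)
    ; minIn-inBlock = λ j → trans (blockMin-sameBlock f (witness j)) (inBlock j)
    ; minIn-isBlockMin = λ j → blockMin-isBlockMin f (witness j)
    ; minIn-unique = λ {j} fc≡j c-min → blockMin-unique f c-min (blockMin-isBlockMin f (witness j))
        (trans fc≡j (sym (trans (blockMin-sameBlock f (witness j)) (inBlock j))))
    }
    where
    witness = proj₁ ∘ nonempty
    inBlock = proj₂ ∘ nonempty

  ∃!⇒ExtremaTransversal : ∀ {f g} → (∀ j → ∃! _≡_ λ c → f c ≡ j × IsBlockMax g c) →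
    (∀ j → ∃! _≡_ λ c → f c ≡ j × IsBlockMin g c) → ExtremaTransversal f g
  ∃!⇒ExtremaTransversal maxima minima = record
    { maxIn = proj₁ ∘ maxima
    ; maxIn-inBlock = proj₁ ∘ proj₁ ∘ proj₂ ∘ maxima
    ; maxIn-isBlockMax = proj₂ ∘ proj₁ ∘ proj₂ ∘ maxima
    ; maxIn-unique = λ {j} fc≡j c-max → sym (proj₂ (proj₂ (maxima j)) (fc≡j , c-max))
    ; minIn = proj₁ ∘ minima
    ; minIn-inBlock = proj₁ ∘ proj₁ ∘ proj₂ ∘ minima
    ; minIn-isBlockMin = proj₂ ∘ proj₁ ∘ proj₂ ∘ minima
    ; minIn-unique = λ {j} fc≡j c-min → sym (proj₂ (proj₂ (minima j)) (fc≡j , c-min))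
    }

  private
    if-+ : ∀ b u w → (if b then u + w else 0) ≡ (if b then u else 0) + (if b then w else 0)
    if-+ true u w = refl
    if-+ false u w = refl

    ∑-block-single : ∀ (f : Fin n → Fin d) {P : Fin n → Set} (P? : Decidable P) (v : Fin n → ℕ) j c →
      f c ≡ j → P c → (∀ {x} → f x ≡ j → P x → x ≡ c) →
      ∑[ x < n ] (if f x == j then (if does (P? x) then v x else 0) else 0) ≡ v c
    ∑-block-single f P? v j c fc≡j pc unique = trans (sum-single ℕ.+-0-monoid _ c zero-elsewhere) at-c
      where
      zero-elsewhere : ∀ x → x ≢ c → (if f x == j then (if does (P? x) then v x else 0) else 0) ≡ 0
      zero-elsewhere x x≢c with f x Fin.≟ j | P? x
      ... | no _ | _ = refl
      ... | yes _ | no _ = refl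
      ... | yes fx≡j | yes px = ⊥-elim (x≢c (unique fx≡j px))
      at-c : (if f c == j then (if does (P? c) then v c else 0) else 0) ≡ v c
      at-c rewrite ==-≡ fc≡j | dec-true (P? c) pc = refl

  potential-by-blocks : ∀ {f g} → (t : ExtremaTransversal f g) → let open ExtremaTransversal t in
    potential g ≡ ∑[ j < d ] (n ∸ toℕ (maxIn j) + toℕ (minIn j))
  potential-by-blocks {f} {g} t = begin
    potential g                                                  ≡⟨ ∑-fibres f (weight g) ⟩
    ∑[ j < d ] ∑[ x < n ] (if f x == j then weight g x else 0)   ≡⟨ sum-cong-≗ split ⟩
    ∑[ j < d ] (∑[ x < n ] maxPart j x + ∑[ x < n ] minPart j x) ≡⟨ sum-cong-≗ single ⟩
    ∑[ j < d ] (n ∸ toℕ (maxIn j) + toℕ (minIn j))              ∎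
    where
    open ≡-Reasoning
    open ExtremaTransversal t
    maxPart minPart : Fin d → Fin n → ℕ
    maxPart j x = if f x == j then (if does (isBlockMax? g x) then n ∸ toℕ x else 0) else 0
    minPart j x = if f x == j then (if does (isBlockMin? g x) then toℕ x else 0) else 0
    split : ∀ j → ∑[ x < n ] (if f x == j then weight g x else 0) ≡ ∑[ x < n ] maxPart j x + ∑[ x < n ] minPart j x
    split j = trans (sum-cong-≗ (λ x → if-+ (f x == j) _ _)) (∑-distrib-+ (maxPart j) (minPart j))
    single : ∀ j → ∑[ x < n ] maxPart j x + ∑[ x < n ] minPart j x ≡ n ∸ toℕ (maxIn j) + toℕ (minIn j)
    single j = cong₂ _+_
      (∑-block-single f (isBlockMax? g) _ j (maxIn j) (maxIn-inBlock j) (maxIn-isBlockMax j) maxIn-unique)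
      (∑-block-single f (isBlockMin? g) _ j (minIn j) (minIn-inBlock j) (minIn-isBlockMin j) minIn-unique)

  potential-< : ∀ {f g} → (∀ j → ∃ λ x → f x ≡ j) → IsNoncrossing f → IsNoncrossing g →
    ExtremaTransversal f g → ¬ SamePartition f g → potential f < potential g
  potential-< {f} {g} nonempty f-nc g-nc t f≁g =
    subst₂ _<_ (sym (potential-by-blocks self)) (sym (potential-by-blocks t))
      (∑-mono-< termwise (proj₁ disagreement) (strict (proj₂ disagreement)))
    where
    self = self-transversal nonempty
    open ExtremaTransversal t
    module F = ExtremaTransversal self

    a≤M : ∀ j → maxIn j Fin.≤ F.maxIn j
    a≤M j = F.maxIn-isBlockMax j (maxIn j) (trans (maxIn-inBlock j) (sym (F.maxIn-inBlock j)))

    m≤b : ∀ j → F.minIn j Fin.≤ minIn j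
    m≤b j = F.minIn-isBlockMin j (minIn j) (trans (minIn-inBlock j) (sym (F.minIn-inBlock j)))

    Agree : Fin d → Set
    Agree j = maxIn j ≡ F.maxIn j × minIn j ≡ F.minIn j

    same-extrema : (∀ j → Agree j) → SameExtrema f g
    same-extrema agree =
      (λ x → mk⇔
        (λ x-max → subst (IsBlockMax g) (trans (proj₁ (agree (f x))) (sym (F.maxIn-unique refl x-max))) (maxIn-isBlockMax (f x)))
        (λ x-max → subst (IsBlockMax f) (trans (sym (proj₁ (agree (f x)))) (sym (maxIn-unique refl x-max))) (F.maxIn-isBlockMax (f x)))) ,
      (λ x → mk⇔
        (λ x-min → subst (IsBlockMin g) (trans (proj₂ (agree (f x))) (sym (F.minIn-unique refl x-min))) (minIn-isBlockMin (f x)))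
        (λ x-min → subst (IsBlockMin f) (trans (sym (proj₂ (agree (f x)))) (sym (minIn-unique refl x-min))) (F.minIn-isBlockMin (f x))))

    disagreement : ∃ λ j → ¬ Agree j
    disagreement = Fin.¬∀⟶∃¬ d Agree (λ j → (maxIn j Fin.≟ F.maxIn j) ×-dec (minIn j Fin.≟ F.minIn j))
                     (f≁g ∘ noncrossing-determined-by-extrema f-nc g-nc ∘ same-extrema)

    termwise : ∀ j → n ∸ toℕ (F.maxIn j) + toℕ (F.minIn j) ≤ n ∸ toℕ (maxIn j) + toℕ (minIn j)
    termwise j = ℕ.+-mono-≤ (ℕ.∸-monoʳ-≤ n (a≤M j)) (m≤b j)

    strict : ∀ {j} → ¬ Agree j → n ∸ toℕ (F.maxIn j) + toℕ (F.minIn j) < n ∸ toℕ (maxIn j) + toℕ (minIn j)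
    strict {j} ¬agree with maxIn j Fin.≟ F.maxIn j
    ... | no a≢M = ℕ.+-mono-<-≤ (ℕ.∸-monoʳ-< (Fin.≤∧≢⇒< (a≤M j) a≢M) (ℕ.<⇒≤ (Fin.toℕ<n _))) (m≤b j)
    ... | yes a≡M = ℕ.+-mono-≤-< (ℕ.≤-reflexive (cong (λ x → n ∸ toℕ x) (sym a≡M)))
                      (Fin.≤∧≢⇒< (m≤b j) (λ m≡b → ¬agree (a≡M , sym m≡b)))

exponent : ∀ {n} → List (Var n) → Exponent n
exponent u i j = countVar (i , j) u

Matches : ∀ {n} → List (Var n) → Exponent n → Set
Matches u e = ∀ i j → countVar (i , j) u ≡ e i j

∈⇔countVar-pos : ∀ {n} {v : Var n} {u} → v ∈ u ⇔ 0 < countVar v u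
∈⇔countVar-pos = mk⇔ ∈⇒pos pos⇒∈
  where
  ∈⇒pos : ∀ {n} {v : Var n} {u} → v ∈ u → 0 < countVar v u
  ∈⇒pos {v = i , j} (here refl) rewrite ==-refl i | ==-refl j = s≤s z≤n
  ∈⇒pos {u = _ ∷ u} (there v∈u) = ℕ.<-≤-trans (∈⇒pos v∈u) (ℕ.m≤n+m _ _)
  pos⇒∈ : ∀ {n} {v : Var n} {u} → 0 < countVar v u → v ∈ u
  pos⇒∈ {v = i , j} {(i′ , j′) ∷ u} pos with i == i′ in i≟i′ | j == j′ in j≟j′
  ... | true | true = here (cong₂ _,_ (to T-== (subst Bool.T (sym i≟i′) _)) (to T-== (subst Bool.T (sym j≟j′) _)))
  ... | true | false = there (pos⇒∈ pos)
  ... | false | _ = there (pos⇒∈ pos)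

Matches-exponent⇒⊆ : ∀ {n} {u u′ : List (Var n)} → Matches u (exponent u′) → u ⊆ u′
Matches-exponent⇒⊆ {u = u} {u′} m {i , j} v∈u = from ∈⇔countVar-pos (subst (0 <_) (m i j) (to ∈⇔countVar-pos v∈u))

Matches-exponent⇒⊇ : ∀ {n} {u u′ : List (Var n)} → Matches u (exponent u′) → u′ ⊆ u
Matches-exponent⇒⊇ {u = u} {u′} m {i , j} v∈u′ = from ∈⇔countVar-pos (subst (0 <_) (sym (m i j)) (to ∈⇔countVar-pos v∈u′))

module _ {n : ℕ} where

  private
    matchesᵇ : List (Var n) → Exponent n → Bool
    matchesᵇ u e = allF n (λ i → allF n (λ j → countVar (i , j) u ℕ.≡ᵇ e i j))

    T-matchesᵇ : ∀ u e → Bool.T (matchesᵇ u e) ⇔ Matches u e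
    T-matchesᵇ u e = mk⇔ (λ m i j → ℕ.≡ᵇ⇒≡ _ _ (to (T-allF n) (to (T-allF n) m i) j))
                     (λ m → from (T-allF n) (λ i → from (T-allF n) (λ j → ℕ.≡⇒≡ᵇ _ _ (m i j))))

    matchCount : Poly n → Exponent n → ℕ
    matchCount [] e = 0
    matchCount ((_ , u) ∷ p) e = (if matchesᵇ u e then 1 else 0) + matchCount p e

    coeff-agreeing : ∀ (p : Poly n) e c → (∀ {t} → t ∈ p → Matches (proj₂ t) e → proj₁ t ≡ c) →
      coeff p e ≡ ℤ.+ matchCount p e ℤ.* c
    coeff-agreeing [] e c _ = sym (ℤ.*-zeroˡ c)
    coeff-agreeing ((a , u) ∷ p) e c agree with matchesᵇ u e in m
    ... | true rewrite agree (here refl) (to (T-matchesᵇ u e) (subst Bool.T (sym m) _)) | coeff-agreeing p e c (agree ∘ there) =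
      trans (cong (ℤ._+ (ℤ.+ matchCount p e ℤ.* c)) (sym (ℤ.*-identityˡ c)))
            (sym (ℤ.*-distribʳ-+ c (ℤ.+ 1) (ℤ.+ matchCount p e)))
    ... | false rewrite coeff-agreeing p e c (agree ∘ there) = ℤ.+-identityˡ _

    matchCount-pos : ∀ (p : Poly n) e {t} → t ∈ p → Matches (proj₂ t) e → 0 < matchCount p e
    matchCount-pos ((a , u) ∷ p) e (here refl) mt with matchesᵇ u e in m
    ... | true = s≤s z≤n
    ... | false = ⊥-elim (subst Bool.T m (from (T-matchesᵇ u e) mt))
    matchCount-pos ((a , u) ∷ p) e (there t∈p) m = ℕ.<-≤-trans (matchCount-pos p e t∈p m) (ℕ.m≤n+m _ _)

  coeff≢0⇒matchingTerm : ∀ (p : Poly n) e → coeff p e ≢ ℤ.+ 0 → ∃ λ t → t ∈ p × Matches (proj₂ t) e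
  coeff≢0⇒matchingTerm [] e c≢0 = ⊥-elim (c≢0 refl)
  coeff≢0⇒matchingTerm ((a , u) ∷ p) e c≢0 with matchesᵇ u e in m
  ... | true = (a , u) , here refl , to (T-matchesᵇ u e) (subst Bool.T (sym m) _)
  ... | false = Product.map₂ (Product.map₁ there) (coeff≢0⇒matchingTerm p e (c≢0 ∘ trans (ℤ.+-identityˡ _)))

  coeff≢0-if-matchingTerms-agree : ∀ (p : Poly n) e {c t} → c ≢ ℤ.+ 0 →
    (∀ {t} → t ∈ p → Matches (proj₂ t) e → proj₁ t ≡ c) → t ∈ p → Matches (proj₂ t) e → coeff p e ≢ ℤ.+ 0
  coeff≢0-if-matchingTerms-agree p e {c} c≢0 agree t∈p m coeff≡0
    with matchCount p e | matchCount-pos p e t∈p m | coeff-agreeing p e c agree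
  ... | suc k | _ | coeff≡k*c with ℤ.i*j≡0⇒i≡0∨j≡0 (ℤ.+ suc k) (trans (sym coeff≡k*c) coeff≡0)
  ...   | inj₂ c≡0 = c≢0 c≡0

sgn≢0 : ∀ k → sgn k ≢ ℤ.+ 0
sgn≢0 zero ()
sgn≢0 (suc k) -s≡0 = sgn≢0 k (ℤ.neg-injective -s≡0)

*-≢0 : ∀ {i j} → i ≢ ℤ.+ 0 → j ≢ ℤ.+ 0 → i ℤ.* j ≢ ℤ.+ 0
*-≢0 {i} i≢0 j≢0 ij≡0 = [ i≢0 , j≢0 ]′ (ℤ.i*j≡0⇒i≡0∨j≡0 i ij≡0)

module _ {n d : ℕ} (rows : Fin d → List (Fin n)) (σ : Fin d → List (Fin n)) where

  termMonomial : List (Fin d) → List (Var n)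
  termMonomial [] = []
  termMonomial (j ∷ js) = List.zip (rows j) (σ j) List.++ termMonomial js

  ∈-termMonomial⁻ : ∀ js {v} → v ∈ termMonomial js → ∃ λ j → v ∈ List.zip (rows j) (σ j)
  ∈-termMonomial⁻ (j ∷ js) v∈ with ∈-++⁻ (List.zip (rows j) (σ j)) v∈
  ... | inj₁ v∈j = j , v∈j
  ... | inj₂ v∈js = ∈-termMonomial⁻ js v∈js

  ∈-termMonomial⁺ : ∀ {js j v} → j ∈ js → v ∈ List.zip (rows j) (σ j) → v ∈ termMonomial js
  ∈-termMonomial⁺ (here refl) v∈ = ∈-++⁺ˡ v∈
  ∈-termMonomial⁺ {j′ ∷ _} (there j∈js) v∈ = ∈-++⁺ʳ (List.zip (rows j′) (σ j′)) (∈-termMonomial⁺ j∈js v∈)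

termSign : ∀ {n d} → (Fin d → List (Fin n)) → List (Fin d) → ℤ
termSign σ [] = ℤ.+ 1
termSign σ (j ∷ js) = sgn (inv (σ j)) ℤ.* termSign σ js

termSign≢0 : ∀ {n d} (σ : Fin d → List (Fin n)) js → termSign σ js ≢ ℤ.+ 0
termSign≢0 σ [] ()
termSign≢0 σ (j ∷ js) = *-≢0 (sgn≢0 (inv (σ j))) (termSign≢0 σ js)

module _ {n d : ℕ} {σ σ′ : Fin d → List (Fin n)} where

  termMonomial-cong : ∀ {rows} js → (∀ {j} → j ∈ js → σ j ≡ σ′ j) → termMonomial rows σ js ≡ termMonomial rows σ′ js
  termMonomial-cong [] _ = refl
  termMonomial-cong {rows} (j ∷ js) σ≡σ′ =
    cong₂ List._++_ (cong (List.zip (rows j)) (σ≡σ′ (here refl))) (termMonomial-cong js (σ≡σ′ ∘ there))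

  termSign-cong : ∀ js → (∀ {j} → j ∈ js → σ j ≡ σ′ j) → termSign σ js ≡ termSign σ′ js
  termSign-cong [] _ = refl
  termSign-cong (j ∷ js) σ≡σ′ =
    cong₂ ℤ._*_ (cong (λ τ → sgn (inv τ)) (σ≡σ′ (here refl))) (termSign-cong js (σ≡σ′ ∘ there))

module _ {n : ℕ} where

  ∈-polyMul⁻ : ∀ (p q : Poly n) {t} → t ∈ polyMul p q →
    ∃ λ a → ∃ λ u → ∃ λ b → ∃ λ v → (a , u) ∈ p × (b , v) ∈ q × t ≡ (a ℤ.* b , u List.++ v)
  ∈-polyMul⁻ p q t∈ with find (∈-concatMap⁻ _ {xs = p} t∈)
  ... | (a , u) , au∈p , t∈′ with ∈-map⁻ _ t∈′
  ... | (b , v) , bv∈q , refl = a , u , b , v , au∈p , bv∈q , refl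

  ∈-polyMul⁺ : ∀ (p q : Poly n) {a u b v} → (a , u) ∈ p → (b , v) ∈ q → (a ℤ.* b , u List.++ v) ∈ polyMul p q
  ∈-polyMul⁺ p q {a} {u} au∈p bv∈q =
    ∈-concatMap⁺ _ (lose au∈p (∈-map⁺ (λ { (b , v) → (a ℤ.* b , u List.++ v) }) bv∈q))

module _ {n d : ℕ} (rows cols : Fin d → List (Fin n)) where

  minorProduct : List (Fin d) → Poly n
  minorProduct js = polyProd (map (λ j → minor (rows j) (cols j)) js)

  ∈-minorProduct⁻ : ∀ {js t} → Unique js → t ∈ minorProduct js →
    ∃ λ σ → (∀ {j} → j ∈ js → σ j ∈ perms (cols j)) × t ≡ (termSign σ js , termMonomial rows σ js)
  ∈-minorProduct⁻ {[]} [] (here refl) = (λ _ → []) , (λ ()) , refl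
  ∈-minorProduct⁻ {j ∷ js} (j∉js ∷ js!) t∈ with ∈-polyMul⁻ _ _ t∈
  ... | a , u , b , v , au∈ , bv∈ , refl
    with ∈-map⁻ (λ τ → (sgn (inv τ) , List.zip (rows j) τ)) au∈ | ∈-minorProduct⁻ js! bv∈
  ... | τ , τ∈ , refl | σ , σ∈ , refl =
    σ′ , σ′∈ , cong₂ _,_ (cong₂ ℤ._*_ (cong (λ τ → sgn (inv τ)) (sym σ′j)) (termSign-cong js agree))
                         (cong₂ List._++_ (cong (List.zip (rows j)) (sym σ′j)) (termMonomial-cong js agree))
    where
    σ′ : Fin d → List (Fin n)
    σ′ k = if k == j then τ else σ k
    σ′j : σ′ j ≡ τ
    σ′j = cong (if_then τ else σ j) (==-refl j)
    agree : ∀ {k} → k ∈ js → σ k ≡ σ′ k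
    agree {k} k∈js = cong (if_then τ else σ k) (sym (==-≢ λ k≡j → All.lookup j∉js k∈js (sym k≡j)))
    σ′∈ : ∀ {k} → k ∈ j ∷ js → σ′ k ∈ perms (cols k)
    σ′∈ (here refl) = subst (_∈ perms (cols j)) (sym σ′j) τ∈
    σ′∈ {k} (there k∈js) = subst (_∈ perms (cols k)) (agree k∈js) (σ∈ k∈js)

  ∈-minorProduct⁺ : ∀ js σ → (∀ {j} → j ∈ js → σ j ∈ perms (cols j)) →
    (termSign σ js , termMonomial rows σ js) ∈ minorProduct js
  ∈-minorProduct⁺ [] σ _ = here refl
  ∈-minorProduct⁺ (j ∷ js) σ σ∈ =
    ∈-polyMul⁺ _ _ (∈-map⁺ (λ τ → (sgn (inv τ) , List.zip (rows j) τ)) (σ∈ (here refl)))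
                   (∈-minorProduct⁺ js σ (σ∈ ∘ there))

-- A triangularity criterion for linear independence

module _ {c ℓ} (R : CommutativeRing c ℓ) (char0-domain : IsCharZeroDomain R) where
  open CommutativeRing R using (Carrier; _≈_; _*_; -_; 0#; setoid; +-monoid; +-group; -‿cong; *-congʳ; zeroˡ; zeroʳ)
  open import Algebra.Properties.Group +-group using (⁻¹-involutive; ε⁻¹≈ε)
  open import Algebra.Properties.Monoid.Sum +-monoid using () renaming (sum to sum⁺)
  open import Relation.Binary.Reasoning.Setoid setoid
  module ≈ = CommutativeRing R

  private
    sumR≡sum⁺ : ∀ k (t : Fin k → Carrier) → sumR R k t ≡ sum⁺ t
    sumR≡sum⁺ zero t = refl
    sumR≡sum⁺ (suc k) t = cong (t Fin.zero ≈.+_) (sumR≡sum⁺ k (t ∘ Fin.suc))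

    intR-≉0 : ∀ z → z ≢ ℤ.+ 0 → ¬ intR R z ≈ 0#
    intR-≉0 (ℤ.+ zero) z≢0 _ = z≢0 refl
    intR-≉0 (ℤ.+ suc k) _ = proj₁ char0-domain k
    intR-≉0 ℤ.-[1+ k ] _ -x≈0 = proj₁ char0-domain k (begin
      natR R (suc k)       ≈⟨ ⁻¹-involutive _ ⟨
      - - natR R (suc k)   ≈⟨ -‿cong -x≈0 ⟩
      - 0#                 ≈⟨ ε⁻¹≈ε ⟩
      0#                   ∎)

  triangular⇒linearlyIndependent : ∀ {n} (ps : List (Poly n))
    (e : Fin (List.length ps) → Exponent n) (μ : Fin (List.length ps) → ℕ) →
    (∀ k → coeff (List.lookup ps k) (e k) ≢ ℤ.+ 0) →
    (∀ k k′ → k′ ≢ k → coeff (List.lookup ps k′) (e k) ≢ ℤ.+ 0 → μ k′ < μ k) →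
    LinearlyIndependent R ps
  triangular⇒linearlyIndependent ps e μ diagonal triangular a vanishes =
    All.wfRec (On.wellFounded μ ℕ.<-wellFounded) _ (λ k → a k ≈ 0#) step
    where
    step : ∀ k → (∀ {k′} → μ k′ < μ k → a k′ ≈ 0#) → a k ≈ 0#
    step k IH with proj₂ char0-domain (a k) (intR R (coeff (List.lookup ps k) (e k))) diagonal-term
      where
      term : Fin (List.length ps) → Carrier
      term k′ = a k′ * intR R (coeff (List.lookup ps k′) (e k))
      off-diagonal : ∀ k′ → k′ ≢ k → term k′ ≈ 0#
      off-diagonal k′ k′≢k with coeff (List.lookup ps k′) (e k) ℤ.≟ ℤ.+ 0
      ... | yes c≡0 rewrite c≡0 = zeroʳ (a k′)
      ... | no c≢0 = ≈.trans (*-congʳ (IH (triangular k k′ k′≢k c≢0))) (zeroˡ _)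
      diagonal-term : term k ≈ 0#
      diagonal-term = begin
        term k                               ≈⟨ sum-single +-monoid term k off-diagonal ⟨
        sum⁺ term                            ≡⟨ sumR≡sum⁺ _ term ⟨
        sumR R (List.length ps) term         ≈⟨ vanishes (e k) ⟩
        0#                                   ∎
    ... | inj₁ ak≈0 = ak≈0
    ... | inj₂ c≈0 = ⊥-elim (intR-≉0 _ (diagonal k) c≈0)

T-isEntry : ∀ {n} (c : Maybe (Fin n)) x → Bool.T (isEntry c x) ⇔ c ≡ just x
T-isEntry nothing x = mk⇔ (λ ()) (λ ())
T-isEntry (just y) x = mk⇔ (cong just ∘ to T-==) (from T-== ∘ Maybe.just-injective)

record IsJellyfishTableau {n N d : ℕ} (r : ℕ) (f : Fin n → Fin d) (T : Array n N d) : Set where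
  field
    full : ∀ i j → toℕ i < r → Bool.T (is-just (cell T i j))
    single : ∀ i → r ≤ toℕ i → countF d (λ j → is-just (cell T i j)) ≡ 1
    column-⊆ : ∀ {i j x} → cell T i j ≡ just x → f x ≡ j
    column-⊇ : ∀ {j x} → f x ≡ j → ∃ λ i → cell T i j ≡ just x
    increasing : ∀ j {i i′} → i Fin.< i′ → Bool.T (increasingPair (cell T i j) (cell T i′ j))

module _ {n d : ℕ} (r : ℕ) (f : Fin n → Fin d) (T : Array n (nRows n d r) d) where

  private
    N = nRows n d r

    C₁ C₂ C₃ C₄ : Bool
    C₁ = allF N (λ i → (toℕ i ℕ.<ᵇ r) ⇒ᵇ allF d (λ j → is-just (cell T i j)))
    C₂ = allF N (λ i → (r ℕ.≤ᵇ toℕ i) ⇒ᵇ (countF d (λ j → is-just (cell T i j)) ℕ.≡ᵇ 1))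
    C₃ = allF d (λ j → allF n (λ x → (anyF N (λ i → isEntry (cell T i j) x) ⇒ᵇ (f x == j))
                                   ∧ ((f x == j) ⇒ᵇ anyF N (λ i → isEntry (cell T i j) x))))
    C₄ = allF d (λ j → allF N (λ i → allF N (λ i′ →
           (toℕ i ℕ.<ᵇ toℕ i′) ⇒ᵇ increasingPair (cell T i j) (cell T i′ j))))

    T-conditions : Bool.T (isJellyfish r f T) ⇔ (Bool.T C₁ × Bool.T C₂ × Bool.T C₃ × Bool.T C₄)
    T-conditions = mk⇔
      (λ jf → let (c₁ , c₂₃₄) = to (T-∧ {C₁}) jf ; (c₂ , c₃₄) = to (T-∧ {C₂}) c₂₃₄
              in c₁ , c₂ , to (T-∧ {C₃}) c₃₄)
      (λ (c₁ , c₂ , c₃ , c₄) → from (T-∧ {C₁}) (c₁ , from (T-∧ {C₂}) (c₂ , from (T-∧ {C₃}) (c₃ , c₄))))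

    T-column : ∀ j x →
      Bool.T ((anyF N (λ i → isEntry (cell T i j) x) ⇒ᵇ (f x == j)) ∧ ((f x == j) ⇒ᵇ anyF N (λ i → isEntry (cell T i j) x)))
      ⇔ ((∀ {i} → cell T i j ≡ just x → f x ≡ j) × (f x ≡ j → ∃ λ i → cell T i j ≡ just x))
    T-column j x = mk⇔
      (λ c → let (entries⊆ , entries⊇) = to T-∧ c in
        (λ {i} e → to T-== (to T-⇒ᵇ entries⊆ (from (T-anyF N) (i , from (T-isEntry _ x) e)))) ,
        (λ e → Product.map₂ (to (T-isEntry _ x)) (to (T-anyF N) (to T-⇒ᵇ entries⊇ (from T-== e)))))
      (λ (entries⊆ , entries⊇) → from T-∧
        ( from T-⇒ᵇ (λ a → from T-== (entries⊆ (to (T-isEntry _ x) (proj₂ (to (T-anyF N) a)))))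
        , from T-⇒ᵇ (λ e → from (T-anyF N) (Product.map₂ (from (T-isEntry _ x)) (entries⊇ (to T-== e))))))

  T-isJellyfish : Bool.T (isJellyfish r f T) ⇔ IsJellyfishTableau r f T
  T-isJellyfish = mk⇔ decode encode
    where
    decode : Bool.T (isJellyfish r f T) → IsJellyfishTableau r f T
    decode jf = record
      { full = λ i j i<r → to (T-allF d) (to T-⇒ᵇ (to (T-allF N) c₁ i) (ℕ.<⇒<ᵇ i<r)) j
      ; single = λ i r≤i → ℕ.≡ᵇ⇒≡ _ _ (to T-⇒ᵇ (to (T-allF N) c₂ i) (ℕ.≤⇒≤ᵇ r≤i))
      ; column-⊆ = λ {i} {j} {x} → proj₁ (to (T-column j x) (to (T-allF n) (to (T-allF d) c₃ j) x))
      ; column-⊇ = λ {j} {x} → proj₂ (to (T-column j x) (to (T-allF n) (to (T-allF d) c₃ j) x))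
      ; increasing = λ j {i} {i′} i<i′ → to T-⇒ᵇ (to (T-allF N) (to (T-allF N) (to (T-allF d) c₄ j) i) i′) (ℕ.<⇒<ᵇ i<i′)
      }
      where
      c₁ : Bool.T C₁
      c₁ = proj₁ (to T-conditions jf)
      c₂ : Bool.T C₂
      c₂ = proj₁ (proj₂ (to T-conditions jf))
      c₃ : Bool.T C₃
      c₃ = proj₁ (proj₂ (proj₂ (to T-conditions jf)))
      c₄ : Bool.T C₄
      c₄ = proj₂ (proj₂ (proj₂ (to T-conditions jf)))
    encode : IsJellyfishTableau r f T → Bool.T (isJellyfish r f T)
    encode J = from T-conditions (c₁ , c₂ , c₃ , c₄)
      where
      open IsJellyfishTableau J
      c₁ : Bool.T C₁
      c₁ = from (T-allF N) (λ i → from T-⇒ᵇ (λ i<r → from (T-allF d) (λ j → full i j (ℕ.<ᵇ⇒< _ _ i<r))))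
      c₂ : Bool.T C₂
      c₂ = from (T-allF N) (λ i → from T-⇒ᵇ (λ r≤i → ℕ.≡⇒≡ᵇ _ _ (single i (ℕ.≤ᵇ⇒≤ _ _ r≤i))))
      c₃ : Bool.T C₃
      c₃ = from (T-allF d) (λ j → from (T-allF n) (λ x → from (T-column j x) (column-⊆ , column-⊇)))
      c₄ : Bool.T C₄
      c₄ = from (T-allF d) (λ j → from (T-allF N) (λ i → from (T-allF N) (λ i′ →
             from T-⇒ᵇ (λ i<i′ → increasing j (ℕ.<ᵇ⇒< _ _ i<i′)))))

increasingPair-intro : ∀ {n} {m m′ : Maybe (Fin n)} → (∀ {x x′} → m ≡ just x → m′ ≡ just x′ → x Fin.< x′) →
  Bool.T (increasingPair m m′)
increasingPair-intro {m = just x} {just x′} <-if-just = ℕ.<⇒<ᵇ (<-if-just refl refl)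
increasingPair-intro {m = just x} {nothing} _ = _
increasingPair-intro {m = nothing} {just x′} _ = _
increasingPair-intro {m = nothing} {nothing} _ = _

filterᵇ-allFin-first-two : ∀ {M} (p : Fin M → Bool) {i₀ i₁ : Fin M} → toℕ i₀ ≡ 0 → toℕ i₁ ≡ 1 →
  Bool.T (p i₀) → Bool.T (p i₁) → ∃ λ rest → List.filterᵇ p (allFin M) ≡ i₀ ∷ i₁ ∷ rest
filterᵇ-allFin-first-two p {Fin.zero} {Fin.suc Fin.zero} refl refl p₀ p₁ =
  _ , trans (List.filter-accept (Bool.T? ∘ p) p₀) (cong (Fin.zero ∷_) (List.filter-accept (Bool.T? ∘ p) p₁))

column : ∀ {n N d} → Array n N d → Fin d → List (Fin n)
column {N = N} T j = List.mapMaybe (λ i → cell T i j) (allFin N)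

module _ {n N d r} {f : Fin n → Fin d} {T : Array n N d} (J : IsJellyfishTableau r f T) where
  open IsJellyfishTableau J

  column≡block : ∀ j → column T j ≡ block f j
  column≡block j = AllPairs-⊆-antisym Fin.<-asym increasing-column (block-increasing f j)
    (λ x∈ → let (i , _ , cell≡x) = ∈-mapMaybe⁻ _ (allFin N) x∈ in ∈-block⁺ f (column-⊆ cell≡x))
    (λ x∈ → let (i , cell≡x) = column-⊇ (∈-block⁻ f x∈) in ∈-mapMaybe⁺ _ (allFin N) (∈-allFin i) cell≡x)
    where
    increasing-column : Increasing (column T j)
    increasing-column = mapMaybe-AllPairs _ (AllPairs.tabulate⁺-< id) entries-<
      where
      entries-< : ∀ {i i′ x x′} → i Fin.< i′ → cell T i j ≡ just x → cell T i′ j ≡ just x′ → x Fin.< x′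
      entries-< {i} {i′} i<i′ cell≡x cell≡x′ =
        ℕ.<ᵇ⇒< _ _ (subst₂ (λ c c′ → Bool.T (increasingPair c c′)) cell≡x cell≡x′ (increasing j i<i′))

  length-block≤rows : ∀ j → List.length (block f j) ≤ N
  length-block≤rows j = subst (_≤ N) (cong List.length (column≡block j))
    (ℕ.≤-trans (List.length-mapMaybe _ (allFin N)) (ℕ.≤-reflexive (List.length-tabulate id)))

∈-allVecs : ∀ {A : Set} {xs : List A} → (∀ a → a ∈ xs) → ∀ {k} (v : Vec A k) → v ∈ allVecs xs k
∈-allVecs every Vec.[] = here refl
∈-allVecs {xs = xs} every {suc k} (a Vec.∷ v) =
  ∈-concatMap⁺ (λ x → map (x Vec.∷_) (allVecs xs k)) (lose (every a) (∈-map⁺ (a Vec.∷_) (∈-allVecs every v)))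

∈-allArrays : ∀ {n N d} (T : Array n N d) → T ∈ allArrays n N d
∈-allArrays {n} = ∈-allVecs (∈-allVecs every-cell)
  where
  every-cell : ∀ (c : Maybe (Fin n)) → c ∈ nothing ∷ map just (allFin n)
  every-cell nothing = here refl
  every-cell (just x) = there (∈-map⁺ just (∈-allFin x))

record BracketTerm {n d : ℕ} (r : ℕ) (f : Fin n → Fin d) : Set where
  field
    tableau : Array n (nRows n d r) d
    jellyfish : IsJellyfishTableau r f tableau
    perm : Fin d → List (Fin n)
    perm-∈ : ∀ j → perm j ∈ perms (block f j)

  coefficient : ℤ
  coefficient = sgn (inv (readingWord tableau)) ℤ.* termSign perm (allFin d)

  monomial : List (Var n)
  monomial = termMonomial (rowSet r tableau) perm (allFin d)

private
  rows-arithmetic : ∀ {n d} r L → 1 ≤ d → n ≡ L + d ℕ.* r → n ∸ (d ∸ 1) ℕ.* r ≡ L + r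
  rows-arithmetic {d = suc d′} r L _ refl =
    trans (cong (_∸ d′ ℕ.* r) (sym (ℕ.+-assoc L r (d′ ℕ.* r)))) (ℕ.m+n∸n≡m (L + r) (d′ ℕ.* r))

-- Rows 0, …, r − 1 hold the r smallest elements of every block; each remaining element gets a
-- row of its own, in the column of its block.
module _ {n d r : ℕ} (g : Fin n → Fin d) (g-op : IsOP n d r g) (1≤d : 1 ≤ d) where

  private
    overflow : List (Fin n)
    overflow = List.concatMap (λ j → List.drop r (block g j)) (allFin d)

    ∈-overflow⁺ : ∀ {j x} → x ∈ List.drop r (block g j) → x ∈ overflow
    ∈-overflow⁺ {j} x∈ = ∈-concatMap⁺ (λ j → List.drop r (block g j)) (lose (∈-allFin j) x∈)

    ∈-overflow⁻ : ∀ {x} → x ∈ overflow → x ∈ List.drop r (block g (g x))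
    ∈-overflow⁻ x∈ with find (∈-concatMap⁻ (λ j → List.drop r (block g j)) {xs = allFin d} x∈)
    ... | j , _ , x∈j with ∈-block⁻ g (∈-drop⁻ r x∈j)
    ... | refl = x∈j

    overflow-increasing-in-blocks : AllPairs (λ x x′ → g x ≡ g x′ → x Fin.< x′) overflow
    overflow-increasing-in-blocks = AllPairs.concat⁺
      (All.map⁺ (All.tabulate (λ {j} _ → AllPairs.map (λ x<x′ _ → x<x′) (AllPairs.drop⁺ r (block-increasing g j)))))
      (AllPairs.map⁺ (AllPairs.map different-blocks (Unique.allFin⁺ d)))
      where
      different-blocks : ∀ {j j′} → j ≢ j′ →
        All (λ x → All (λ x′ → g x ≡ g x′ → x Fin.< x′) (List.drop r (block g j′))) (List.drop r (block g j))
      different-blocks j≢j′ = All.tabulate (λ x∈ → All.tabulate (λ x′∈ gx≡gx′ →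
        ⊥-elim (j≢j′ (trans (sym (∈-block⁻ g (∈-drop⁻ r x∈))) (trans gx≡gx′ (∈-block⁻ g (∈-drop⁻ r x′∈)))))))

    rows≡ : nRows n d r ≡ List.length overflow + r
    rows≡ = rows-arithmetic r (List.length overflow) 1≤d (begin
      n                                                              ≡⟨ ∑-length-block g ⟨
      ∑[ j < d ] List.length (block g j)                             ≡⟨ sum-cong-≗ (λ j → sym (ℕ.m∸n+n≡m (proj₂ g-op j))) ⟩
      ∑[ j < d ] (List.length (block g j) ∸ r + r)                   ≡⟨ ∑-distrib-+ (λ j → List.length (block g j) ∸ r) (λ _ → r) ⟩
      ∑[ j < d ] (List.length (block g j) ∸ r) + ∑[ j < d ] r        ≡⟨ cong₂ _+_ length-overflow (sym (∑-const d r)) ⟨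
      List.length overflow + d ℕ.* r                                 ∎)
      where
      open ≡-Reasoning
      length-overflow : List.length overflow ≡ ∑[ j < d ] (List.length (block g j) ∸ r)
      length-overflow = trans (length-concatMap-tabulate (λ j → List.drop r (block g j)) id)
                              (sum-cong-≗ (λ j → List.length-drop r (block g j)))

    ownColumn : Maybe (Fin n) → Fin d → Maybe (Fin n)
    ownColumn nothing j = nothing
    ownColumn (just x) j = if g x == j then just x else nothing

    ownColumn-just : ∀ m {j x} → ownColumn m j ≡ just x → m ≡ just x × g x ≡ j
    ownColumn-just (just y) {j} eq with g y == j in gy≟j
    ownColumn-just (just y) refl | true = refl , to T-== (subst Bool.T (sym gy≟j) _)

    canonicalCell : Fin (nRows n d r) → Fin d → Maybe (Fin n)
    canonicalCell i j with toℕ i ℕ.<? r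
    ... | yes _ = nth (block g j) (toℕ i)
    ... | no _ = ownColumn (nth overflow (toℕ i ∸ r)) j

    overflow-row< : ∀ i → ¬ toℕ i < r → toℕ i ∸ r < List.length overflow
    overflow-row< i i≮r = ℕ.+-cancelʳ-< r _ _ (subst₂ _<_ (sym (ℕ.m∸n+n≡m (ℕ.≮⇒≥ i≮r))) rows≡ (Fin.toℕ<n i))

    full : ∀ i j → toℕ i < r → Bool.T (is-just (canonicalCell i j))
    full i j i<r with toℕ i ℕ.<? r
    ... | no i≮r = ⊥-elim (i≮r i<r)
    ... | yes _ with nth-just (block g j) (ℕ.<-≤-trans i<r (proj₂ g-op j))
    ...   | _ , eq rewrite eq = _

    single : ∀ i → r ≤ toℕ i → ∑[ j < d ] (if is-just (canonicalCell i j) then 1 else 0) ≡ 1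
    single i r≤i with toℕ i ℕ.<? r
    ... | yes i<r = ⊥-elim (ℕ.<⇒≱ i<r r≤i)
    ... | no i≮r with nth-just overflow (overflow-row< i i≮r)
    ...   | x , eq rewrite eq = trans (sum-cong-≗ occupancy) (∑-indicator (g x) 1)
      where
      occupancy : ∀ j → (if is-just (ownColumn (just x) j) then 1 else 0) ≡ (if g x == j then 1 else 0)
      occupancy j with g x == j
      ... | true = refl
      ... | false = refl

    column-⊆ : ∀ i j {x} → canonicalCell i j ≡ just x → g x ≡ j
    column-⊆ i j with toℕ i ℕ.<? r
    ... | yes _ = ∈-block⁻ g ∘ nth-∈ (block g j) (toℕ i)
    ... | no _ = proj₂ ∘ ownColumn-just (nth overflow (toℕ i ∸ r))

    column-⊇ : ∀ {j x} → g x ≡ j → ∃ λ i → canonicalCell i j ≡ just x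
    column-⊇ {j} {x} gx≡j with ∈⇒nth (∈-block⁺ g gx≡j)
    ... | k , _ , eq with k ℕ.<? r
    ...   | yes k<r = i , at-i
      where
      i = Fin.fromℕ< (subst (k <_) (sym rows≡) (ℕ.<-≤-trans k<r (ℕ.m≤n+m r _)))
      at-i : canonicalCell i j ≡ just x
      at-i with toℕ i ℕ.<? r
      ... | yes _ = trans (cong (nth (block g j)) (Fin.toℕ-fromℕ< _)) eq
      ... | no i≮r = ⊥-elim (i≮r (subst (_< r) (sym (Fin.toℕ-fromℕ< _)) k<r))
    ...   | no k≮r with ∈⇒nth (∈-overflow⁺ (nth-∈ (List.drop r (block g j)) (k ∸ r)
                                  (trans (nth-drop r (block g j) (k ∸ r))
                                         (trans (cong (nth (block g j)) (ℕ.m+[n∸m]≡n (ℕ.≮⇒≥ k≮r))) eq))))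
    ...     | k₂ , k₂< , eq₂ = i , at-i
      where
      i = Fin.fromℕ< (subst (k₂ + r <_) (sym rows≡) (ℕ.+-monoˡ-< r k₂<))
      toℕ-i : toℕ i ≡ k₂ + r
      toℕ-i = Fin.toℕ-fromℕ< _
      at-i : canonicalCell i j ≡ just x
      at-i with toℕ i ℕ.<? r
      ... | yes i<r = ⊥-elim (ℕ.<⇒≱ i<r (subst (r ≤_) (sym toℕ-i) (ℕ.m≤n+m r k₂)))
      ... | no _ rewrite toℕ-i | ℕ.m+n∸n≡m k₂ r | eq₂ | ==-≡ gx≡j = refl

    increasing : ∀ j {i i′} → i Fin.< i′ →
      ∀ {x x′} → canonicalCell i j ≡ just x → canonicalCell i′ j ≡ just x′ → x Fin.< x′
    increasing j {i} {i′} i<i′ with toℕ i ℕ.<? r | toℕ i′ ℕ.<? r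
    ... | yes _ | yes _ = λ eq eq′ → nth-AllPairs (block-increasing g j) eq eq′ i<i′
    ... | no i≮r | yes i′<r = ⊥-elim (i≮r (ℕ.<-trans i<i′ i′<r))
    ... | yes i<r | no _ = λ eq eq′ → low<high i<r eq (ownColumn-just (nth overflow (toℕ i′ ∸ r)) eq′)
      where
      low<high : ∀ {k x x′} → k < r → nth (block g j) k ≡ just x →
        nth overflow (toℕ i′ ∸ r) ≡ just x′ × g x′ ≡ j → x Fin.< x′
      low<high k<r eq (eq′ , refl) with ∈⇒nth (∈-overflow⁻ (nth-∈ overflow _ eq′))
      ... | k₃ , _ , eq₃ = nth-AllPairs (block-increasing g j) eq (trans (sym (nth-drop r (block g j) k₃)) eq₃)
                             (ℕ.<-≤-trans k<r (ℕ.m≤m+n r k₃))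
    ... | no i≮r | no i′≮r = λ eq eq′ → high<high (ownColumn-just _ eq) (ownColumn-just _ eq′)
      where
      high<high : ∀ {x x′} → nth overflow (toℕ i ∸ r) ≡ just x × g x ≡ j →
        nth overflow (toℕ i′ ∸ r) ≡ just x′ × g x′ ≡ j → x Fin.< x′
      high<high (eq , gx≡j) (eq′ , gx′≡j) =
        nth-AllPairs overflow-increasing-in-blocks eq eq′ (ℕ.∸-monoˡ-< i<i′ (ℕ.≮⇒≥ i≮r)) (trans gx≡j (sym gx′≡j))

  canonicalTableau : Array n (nRows n d r) d
  canonicalTableau = Vec.tabulate (λ i → Vec.tabulate (canonicalCell i))

  canonicalTableau-isJellyfish : IsJellyfishTableau r g canonicalTableau
  canonicalTableau-isJellyfish = record
    { full = λ i j i<r → subst (Bool.T ∘ is-just) (sym (cell≡ i j)) (full i j i<r)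
    ; single = λ i r≤i → trans (length-filter-tabulate (λ j → Bool.T? (is-just (cell canonicalTableau i j))) id)
        (trans (sum-cong-≗ (λ j → cong (λ c → if is-just c then 1 else 0) (cell≡ i j))) (single i r≤i))
    ; column-⊆ = λ {i} {j} eq → column-⊆ i j (trans (sym (cell≡ i j)) eq)
    ; column-⊇ = λ gx≡j → Product.map₂ (λ {i} → trans (cell≡ i _)) (column-⊇ gx≡j)
    ; increasing = λ j {i} {i′} i<i′ → increasingPair-intro (λ eq eq′ →
        increasing j i<i′ (trans (sym (cell≡ i j)) eq) (trans (sym (cell≡ i′ j)) eq′))
    }
    where
    cell≡ : ∀ i j → cell canonicalTableau i j ≡ canonicalCell i j
    cell≡ i j = trans (cong (λ row → Vec.lookup row j) (Vec.lookup∘tabulate _ i)) (Vec.lookup∘tabulate _ j)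

2≤nRows : ∀ {n d r} {g : Fin n → Fin d} → 2 ≤ r → 1 ≤ d → IsOP n d r g → 2 ≤ nRows n d r
2≤nRows {g = g} 2≤r 1≤d g-op = ℕ.≤-trans 2≤r (ℕ.≤-trans (proj₂ g-op j)
  (length-block≤rows (canonicalTableau-isJellyfish g g-op 1≤d) j))
  where
  j = Fin.fromℕ< 1≤d

-- The terms of a bracket and its leading monomial

module _ {n d r : ℕ} where

  rowIndex : Fin (nRows n d r) → Fin n
  rowIndex i = Fin.inject≤ i (ℕ.m∸n≤m n ((d ∸ 1) ℕ.* r))

  rowIndex-injective : ∀ {i i′} → rowIndex i ≡ rowIndex i′ → i ≡ i′
  rowIndex-injective = Fin.inject≤-injective _ _ _ _

  module _ (T : Array n (nRows n d r) d) where

    ∈-rowSet⁺ : ∀ {i j} → Bool.T (is-just (cell T i j)) → rowIndex i ∈ rowSet r T j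
    ∈-rowSet⁺ {i} {j} occupied = ∈-map⁺ rowIndex (∈-filter⁺ (Bool.T? ∘ (λ i → is-just (cell T i j))) (∈-allFin i) occupied)

    ∈-rowSet⁻ : ∀ {j y} → y ∈ rowSet r T j → ∃ λ i → y ≡ rowIndex i × Bool.T (is-just (cell T i j))
    ∈-rowSet⁻ {j} y∈ with ∈-map⁻ rowIndex y∈
    ... | i , i∈ , refl = i , refl , proj₂ (∈-filter⁻ (Bool.T? ∘ (λ i → is-just (cell T i j))) {xs = allFin _} i∈)

    rowSet-unique : ∀ j → Unique (rowSet r T j)
    rowSet-unique j = Unique.map⁺ rowIndex-injective (Unique.filter⁺ _ (Unique.allFin⁺ _))

    rowSet-first-two : ∀ {i₀ i₁ j} → toℕ i₀ ≡ 0 → toℕ i₁ ≡ 1 →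
      Bool.T (is-just (cell T i₀ j)) → Bool.T (is-just (cell T i₁ j)) →
      ∃ λ rest → rowSet r T j ≡ rowIndex i₀ ∷ rowIndex i₁ ∷ rest
    rowSet-first-two {j = j} i₀≡0 i₁≡1 occ₀ occ₁
      with filterᵇ-allFin-first-two (λ i → is-just (cell T i j)) i₀≡0 i₁≡1 occ₀ occ₁
    ... | rest , eq = map rowIndex rest , cong (map rowIndex) eq

    length-rowSet : ∀ {f} → IsJellyfishTableau r f T → ∀ j → List.length (rowSet r T j) ≡ List.length (block f j)
    length-rowSet {f} J j = begin
      List.length (rowSet r T j)                                             ≡⟨ List.length-map rowIndex occupied ⟩
      List.length occupied                                                   ≡⟨ length-filter-is-just (λ i → cell T i j) (allFin _) ⟩
      List.length (column T j)                                               ≡⟨ cong List.length (column≡block J j) ⟩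
      List.length (block f j)                                                ∎
      where
      open ≡-Reasoning
      occupied = List.filterᵇ (λ i → is-just (cell T i j)) (allFin (nRows n d r))

  module _ {f : Fin n → Fin d} where
    open BracketTerm

    ∈-bracket⁻ : ∀ {t} → t ∈ bracket n d r f → ∃ λ (τ : BracketTerm r f) → t ≡ (coefficient τ , monomial τ)
    ∈-bracket⁻ t∈ with find (∈-concatMap⁻ _ {xs = allArrays n (nRows n d r) d} t∈)
    ... | T , _ , t∈T with isJellyfish r f T in jf
    ... | false with () ← t∈T
    ... | true with ∈-map⁻ _ t∈T
    ...   | _ , au∈ , refl with ∈-minorProduct⁻ (rowSet r T) (block f) (Unique.allFin⁺ d) au∈
    ...     | σ , σ∈ , refl = τ , refl
      where
      τ : BracketTerm r f
      τ = record { tableau = T ; jellyfish = to (T-isJellyfish r f T) (subst Bool.T (sym jf) _)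
                 ; perm = σ ; perm-∈ = λ j → σ∈ (∈-allFin j) }

    ∈-bracket⁺ : ∀ (τ : BracketTerm r f) → (coefficient τ , monomial τ) ∈ bracket n d r f
    ∈-bracket⁺ τ = ∈-concatMap⁺ _ (lose (∈-allArrays (tableau τ)) term∈)
      where
      s = sgn (inv (readingWord (tableau τ)))
      term∈ : (coefficient τ , monomial τ) ∈ (if isJellyfish r f (tableau τ) then polyScale s (Jpoly r f (tableau τ)) else [])
      term∈ rewrite to T-≡ (from (T-isJellyfish r f (tableau τ)) (jellyfish τ)) =
        ∈-map⁺ _ (∈-minorProduct⁺ (rowSet r (tableau τ)) (block f) (allFin d) (perm τ) (λ {j} _ → perm-∈ τ j))

  module _ {f : Fin n → Fin d} (τ : BracketTerm r f) where
    open BracketTerm τ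

    coefficient≢0 : coefficient ≢ ℤ.+ 0
    coefficient≢0 = *-≢0 (sgn≢0 (inv (readingWord tableau))) (termSign≢0 perm (allFin d))

    perm-⊆-block : ∀ {j c} → c ∈ perm j → f c ≡ j
    perm-⊆-block {j} c∈ = ∈-block⁻ f (∈-resp-↭ (∈-perms⇒↭ (block f j) (perm-∈ j)) c∈)

    length-perm : ∀ j → List.length (perm j) ≡ List.length (block f j)
    length-perm j = ↭-length (∈-perms⇒↭ (block f j) (perm-∈ j))

    ∈-monomial⁺ : ∀ {j y c} → (y , c) ∈ List.zip (rowSet r tableau j) (perm j) → (y , c) ∈ monomial
    ∈-monomial⁺ = ∈-termMonomial⁺ (rowSet r tableau) perm (∈-allFin _)

    ∈-monomial⇒column : ∀ {j y c} → f c ≡ j → (y , c) ∈ monomial → (y , c) ∈ List.zip (rowSet r tableau j) (perm j)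
    ∈-monomial⇒column refl yc∈ with ∈-termMonomial⁻ (rowSet r tableau) perm (allFin d) yc∈
    ... | j , yc∈j with perm-⊆-block (∈-zip⁻ʳ yc∈j)
    ... | refl = yc∈j

    occupied⇒partner : ∀ {i j} → Bool.T (is-just (cell tableau i j)) → ∃ λ c → f c ≡ j × (rowIndex i , c) ∈ monomial
    occupied⇒partner {i} {j} occupied with ∈-zip-partner (∈-rowSet⁺ tableau occupied)
                                            (trans (length-rowSet tableau jellyfish j) (sym (length-perm j)))
    ... | c , ic∈ = c , perm-⊆-block (∈-zip⁻ʳ ic∈) , ∈-monomial⁺ ic∈

    fullRow-meets-block-once : ∀ i → toℕ i < r → ∀ j → ∃! _≡_ λ c → f c ≡ j × (rowIndex i , c) ∈ monomial
    fullRow-meets-block-once i i<r j with occupied⇒partner (IsJellyfishTableau.full jellyfish i j i<r)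
    ... | c , fc≡j , ic∈ = c , (fc≡j , ic∈) , unique
      where
      unique : ∀ {c′} → f c′ ≡ j × (rowIndex i , c′) ∈ monomial → c ≡ c′
      unique (fc′≡j , ic′∈) =
        zip-functional (rowSet-unique tableau j) (∈-monomial⇒column fc≡j ic∈) (∈-monomial⇒column fc′≡j ic′∈)

  module _ {f : Fin n → Fin d} where
    open BracketTerm

    occupancy-transfer : ∀ (τ τ′ : BracketTerm r f) → monomial τ ⊆ monomial τ′ →
      ∀ {i j} → Bool.T (is-just (cell (tableau τ) i j)) → Bool.T (is-just (cell (tableau τ′) i j))
    occupancy-transfer τ τ′ τ⊆τ′ occupied with occupied⇒partner τ occupied
    ... | c , fc≡j , ic∈ with ∈-rowSet⁻ (tableau τ′) (∈-zip⁻ˡ (∈-monomial⇒column τ′ fc≡j (τ⊆τ′ ic∈)))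
    ... | i′ , i≡i′ , occupied′ =
      subst (λ k → Bool.T (is-just (cell (tableau τ′) k _))) (sym (rowIndex-injective i≡i′)) occupied′

    module _ (τ τ′ : BracketTerm r f) (τ⊆τ′ : monomial τ ⊆ monomial τ′) (τ′⊆τ : monomial τ′ ⊆ monomial τ) where

      tableau-determined : tableau τ ≡ tableau τ′
      tableau-determined = Vec-ext (λ i → Vec-ext (λ j → same-cells i j))
        where
        same-cells : ∀ i j → cell (tableau τ) i j ≡ cell (tableau τ′) i j
        same-cells i j = mapMaybe-determines (λ i → cell (tableau τ) i j) (λ i → cell (tableau τ′) i j) (allFin _)
          (λ i → T-injective (mk⇔ (occupancy-transfer τ τ′ τ⊆τ′) (occupancy-transfer τ′ τ τ′⊆τ)))
          (trans (column≡block (jellyfish τ) j) (sym (column≡block (jellyfish τ′) j))) (∈-allFin i)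

      perm-determined : ∀ j → perm τ j ≡ perm τ′ j
      perm-determined j = zip-injectiveʳ (rowSet-unique (tableau τ) j) (length-zipped τ) (length-zipped τ′) zipped-⊆
        where
        length-zipped : ∀ τ″ → List.length (rowSet r (tableau τ) j) ≡ List.length (perm τ″ j)
        length-zipped τ″ = trans (length-rowSet (tableau τ) (jellyfish τ) j) (sym (length-perm τ″ j))
        zipped-⊆ : ∀ {y c} → (y , c) ∈ List.zip (rowSet r (tableau τ) j) (perm τ j) →
          (y , c) ∈ List.zip (rowSet r (tableau τ) j) (perm τ′ j)
        zipped-⊆ yc∈ = subst (λ T → _ ∈ List.zip (rowSet r T j) (perm τ′ j)) (sym tableau-determined)
          (∈-monomial⇒column τ′ (perm-⊆-block τ (∈-zip⁻ʳ yc∈)) (τ⊆τ′ (∈-monomial⁺ τ yc∈)))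

      coefficient-determined : coefficient τ ≡ coefficient τ′
      coefficient-determined = cong₂ ℤ._*_ (cong (λ T → sgn (inv (readingWord T))) tableau-determined)
                                           (termSign-cong (allFin d) (λ {j} _ → perm-determined j))

  module _ (2≤r : 2 ≤ r) (2≤N : 2 ≤ nRows n d r) {g : Fin n → Fin d}
           {T₀ : Array n (nRows n d r) d} (J₀ : IsJellyfishTableau r g T₀) where
    open BracketTerm

    private
      row₀ row₁ : Fin (nRows n d r)
      row₀ = Fin.fromℕ< (ℕ.<-trans (s≤s z≤n) 2≤N)
      row₁ = Fin.fromℕ< 2≤N

      row₀<r : toℕ row₀ < r
      row₀<r = subst (_< r) (sym (Fin.toℕ-fromℕ< _)) (ℕ.<-trans (s≤s z≤n) 2≤r)

      row₁<r : toℕ row₁ < r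
      row₁<r = subst (_< r) (sym (Fin.toℕ-fromℕ< _)) 2≤r

    leadingTerm : BracketTerm r g
    leadingTerm = record { tableau = T₀ ; jellyfish = J₀ ; perm = rotate ∘ block g ; perm-∈ = rotate-∈-perms ∘ block g }

    private
      leading-column : ∀ j →
        (∃ λ M → g M ≡ j × IsBlockMax g M × (rowIndex row₀ , M) ∈ monomial leadingTerm) ×
        (∃ λ m → g m ≡ j × IsBlockMin g m × (rowIndex row₁ , m) ∈ monomial leadingTerm)
      leading-column j
        with rowSet-first-two T₀ (Fin.toℕ-fromℕ< _) (Fin.toℕ-fromℕ< _)
               (IsJellyfishTableau.full J₀ row₀ j row₀<r) (IsJellyfishTableau.full J₀ row₁ j row₁<r)
      ... | rest , rows≡ with rotate-zip-extrema (block g j) (block-increasing g j)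
                                (trans (cong List.length (sym rows≡)) (length-rowSet T₀ J₀ j))
      ... | (M , M∈ , M-max , M∈zip) , (m , m∈ , m-min , m∈zip) =
        (M , ∈-block⁻ g M∈ , (λ y gy≡gM → M-max (∈-block⁺ g (trans gy≡gM (∈-block⁻ g M∈)))) , in-monomial M∈zip) ,
        (m , ∈-block⁻ g m∈ , (λ y gy≡gm → m-min (∈-block⁺ g (trans gy≡gm (∈-block⁻ g m∈)))) , in-monomial m∈zip)
        where
        in-monomial : ∀ {y c} → (y , c) ∈ List.zip (rowIndex row₀ ∷ rowIndex row₁ ∷ rest) (rotate (block g j)) →
          (y , c) ∈ monomial leadingTerm
        in-monomial yc∈ = ∈-monomial⁺ leadingTerm (subst (λ R → _ ∈ List.zip R (rotate (block g j))) (sym rows≡) yc∈)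

    row₀-of-leadingTerm : ∀ c → (rowIndex row₀ , c) ∈ monomial leadingTerm ⇔ IsBlockMax g c
    row₀-of-leadingTerm c with proj₁ (leading-column (g c))
    ... | M , gM≡gc , M-max , M∈ = mk⇔
      (λ c∈ → subst (IsBlockMax g)
        (∃!-≡ (fullRow-meets-block-once leadingTerm row₀ row₀<r (g c)) (gM≡gc , M∈) (refl , c∈)) M-max)
      (λ c-max → subst (λ x → (rowIndex row₀ , x) ∈ monomial leadingTerm) (blockMax-unique g M-max c-max gM≡gc) M∈)

    row₁-of-leadingTerm : ∀ c → (rowIndex row₁ , c) ∈ monomial leadingTerm ⇔ IsBlockMin g c
    row₁-of-leadingTerm c with proj₂ (leading-column (g c))
    ... | m , gm≡gc , m-min , m∈ = mk⇔
      (λ c∈ → subst (IsBlockMin g)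
        (∃!-≡ (fullRow-meets-block-once leadingTerm row₁ row₁<r (g c)) (gm≡gc , m∈) (refl , c∈)) m-min)
      (λ c-min → subst (λ x → (rowIndex row₁ , x) ∈ monomial leadingTerm) (blockMin-unique g m-min c-min gm≡gc) m∈)

    leadingExponent : Exponent n
    leadingExponent = exponent (monomial leadingTerm)

    coeff-leadingExponent≢0 : coeff (bracket n d r g) leadingExponent ≢ ℤ.+ 0
    coeff-leadingExponent≢0 = coeff≢0-if-matchingTerms-agree (bracket n d r g) leadingExponent
      (coefficient≢0 leadingTerm) agree (∈-bracket⁺ leadingTerm) (λ _ _ → refl)
      where
      agree : ∀ {t} → t ∈ bracket n d r g → Matches (proj₂ t) leadingExponent → proj₁ t ≡ coefficient leadingTerm
      agree t∈ m with ∈-bracket⁻ t∈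
      ... | τ , refl = coefficient-determined τ leadingTerm (Matches-exponent⇒⊆ m) (Matches-exponent⇒⊇ m)

    coeff-leadingExponent≢0⇒transversal : ∀ {f} → coeff (bracket n d r f) leadingExponent ≢ ℤ.+ 0 → ExtremaTransversal f g
    coeff-leadingExponent≢0⇒transversal {f} c≢0 with coeff≢0⇒matchingTerm (bracket n d r f) leadingExponent c≢0
    ... | t , t∈ , m with ∈-bracket⁻ t∈
    ... | τ , refl = ∃!⇒ExtremaTransversal
      (λ j → ∃!-resp-⇔ (λ c → ⇔-refl ×-⇔ ⇔-trans same-variables (row₀-of-leadingTerm c))
                        (fullRow-meets-block-once τ row₀ row₀<r j))
      (λ j → ∃!-resp-⇔ (λ c → ⇔-refl ×-⇔ ⇔-trans same-variables (row₁-of-leadingTerm c))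
                        (fullRow-meets-block-once τ row₁ row₁<r j))
      where
      same-variables : ∀ {v} → v ∈ monomial τ ⇔ v ∈ monomial leadingTerm
      same-variables = mk⇔ (Matches-exponent⇒⊆ m) (Matches-exponent⇒⊇ m)

theorem5p9 : ∀ {c ℓ} (R : CommutativeRing c ℓ) → IsCharZeroDomain R →
    (n d r : ℕ) → 1 ≤ n → 1 ≤ d → 1 < r →
    (πs : List (Fin n → Fin d)) →
    All (IsOP n d r) πs →
    All IsNoncrossing πs →
    AllPairs (λ π π′ → ¬ SamePartition π π′) πs →
    (∀ (f : Fin n → Fin d) → IsOP n d r f → IsNoncrossing f → Any (SamePartition f) πs) →
    LinearlyIndependent R (map (bracket n d r) πs)
theorem5p9 R char0 n d r _ 1≤d 2≤r πs ops ncs distinct _ =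
  triangular⇒linearlyIndependent R char0 (map (bracket n d r) πs) exponentOf (potential ∘ π)
    (λ k → coeff-leadingExponent≢0 2≤r (2≤N k) (J₀ k) ∘ trans (sym (coeff-lookup k k)))
    (λ k k′ k′≢k c≢0 → potential-< (proj₁ (op k′)) (nc k′) (nc k)
      (coeff-leadingExponent≢0⇒transversal 2≤r (2≤N k) (J₀ k) (c≢0 ∘ trans (coeff-lookup k k′)))
      (AllPairs-lookup (λ ¬same → ¬same ∘ SamePartition-sym) distinct (k′≢k ∘ cast-injective)))
  where
  Index : Set
  Index = Fin (List.length (map (bracket n d r) πs))
  π : Index → Fin n → Fin d
  π k = List.lookup πs (Fin.cast (List.length-map (bracket n d r) πs) k)
  op : ∀ k → IsOP n d r (π k)
  op k = All.lookup ops (∈-lookup _)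
  nc : ∀ k → IsNoncrossing (π k)
  nc k = All.lookup ncs (∈-lookup _)
  2≤N : Index → 2 ≤ nRows n d r
  2≤N k = 2≤nRows 2≤r 1≤d (op k)
  J₀ : ∀ k → IsJellyfishTableau r (π k) (canonicalTableau (π k) (op k) 1≤d)
  J₀ k = canonicalTableau-isJellyfish (π k) (op k) 1≤d
  exponentOf : Index → Exponent n
  exponentOf k = leadingExponent 2≤r (2≤N k) (J₀ k)
  coeff-lookup : ∀ k k′ →
    coeff (List.lookup (map (bracket n d r) πs) k′) (exponentOf k) ≡ coeff (bracket n d r (π k′)) (exponentOf k)
  coeff-lookup k k′ = cong (λ p → coeff p (exponentOf k)) (lookup-map (bracket n d r) πs k′)
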